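{- Let $e_1,e_2,\dots\in\mathbb{Z}$ and $E(x)=1+\sum_{j=1}^\infty e_jx^j$. For $n\ge1$ define \[T_n(x)=1+\sum_{k=1}^\infty\frac{n+1-k}{k!}\bigg(\sum_{j=1}^k(-1)^j\frac{(n+j)!}{(n+1)!}B_{k,j}(1!\,e_1,2!\,e_2,\dots)\bigg)x^k.\] Then $T_n(x)=E(x)^{ -n-2}\big(E(x)+xE'(x)\big)$.
   Context: Identities are of formal power series. For a sequence $x_1,x_2,\dots$, the partial Bell polynomial is $B_{n,k}(x_1,x_2,\dots)=\sum \frac{n!}{i_1!i_2!\cdots}\left(\frac{x_1}{1!}\right)^{i_1}\left(\frac{x_2}{2!}\right)^{i_2}\cdots$, the sum over all sequences $(i_1,i_2,\dots)$ of nonnegative integers with $i_1+i_2+\cdots=k$ and $i_1+2i_2+\cdots=n$. -}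

module Defs where

open import Data.Nat as ℕ using (ℕ; zero; suc; _!)
open import Data.Nat.Properties using (_!≢0)
open import Data.Integer as ℤ using (ℤ)
open import Data.Rational using (ℚ; _/_; _+_; _*_; -_; 0ℚ; 1ℚ)
open import Data.List using (List; []; _∷_; concatMap; map; filterᵇ; upTo)
open import Data.Vec as Vec using (Vec; []; _∷_; lookup)
open import Data.Bool using (_∧_)

ℤ→ℚ : ℤ → ℚ
ℤ→ℚ z = z / 1

ℕ→ℚ : ℕ → ℚ
ℕ→ℚ n = ℤ.+ n / 1

fact : ℕ → ℚ
fact n = ℕ→ℚ (n !)

invFact : ℕ → ℚ
invFact n = (ℤ.+ 1 / (n !)) {{n !≢0}}

_^ℚ_ : ℚ → ℕ → ℚ
q ^ℚ zero = 1ℚ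
q ^ℚ suc m = q * (q ^ℚ m)

sign : ℕ → ℚ
sign zero = 1ℚ
sign (suc j) = - sign j

sumTo : ℕ → (ℕ → ℚ) → ℚ
sumTo zero f = f 0
sumTo (suc k) f = sumTo k f + f (suc k)

sumL : List ℚ → ℚ
sumL [] = 0ℚ
sumL (q ∷ qs) = q + sumL qs

-- Partial Bell polynomials
-- A sequence x₁, x₂, … is given as x : ℕ → ℚ with x m = x_m (x 0 unused).
-- An index sequence (i₁,…,i_n) is a vector of length n; for the sums in
-- the definition, i_m = 0 is forced for m > n (since Σ m·i_m = n), and each
-- i_m ≤ n, so enumerating vectors with entries in {0,…,n} is exhaustive.

allVecs : (len b : ℕ) → List (Vec ℕ len)
allVecs zero b = [] ∷ []
allVecs (suc len) b =
  concatMap (λ i → map (i ∷_) (allVecs len b)) (upTo (suc b))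

-- Σ_m i_m and Σ_m m·i_m, for a vector (i_{s+1}, i_{s+2}, …) starting at index s+1
countSum : ∀ {len} → Vec ℕ len → ℕ
countSum [] = 0
countSum (i ∷ is) = i ℕ.+ countSum is

weightSum : ∀ {len} → ℕ → Vec ℕ len → ℕ
weightSum s [] = 0
weightSum s (i ∷ is) = suc s ℕ.* i ℕ.+ weightSum (suc s) is

bellTerm : (n : ℕ) → (ℕ → ℚ) → Vec ℕ n → ℚ
bellTerm n x is = fact n * go 0 is
  where
  go : ∀ {len} → ℕ → Vec ℕ len → ℚ
  go s [] = 1ℚ
  go s (i ∷ js) = invFact i * ((x (suc s) * invFact (suc s)) ^ℚ i) * go (suc s) js

bell : (n k : ℕ) → (ℕ → ℚ) → ℚ
bell n k x =
  sumL (map (bellTerm n x)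
    (filterᵇ (λ is → (countSum is ℕ.≡ᵇ k) ∧ (weightSum 0 is ℕ.≡ᵇ n))
             (allVecs n n)))

Series : Set
Series = ℕ → ℚ

oneS : Series
oneS zero = 1ℚ
oneS (suc _) = 0ℚ

_+S_ : Series → Series → Series
(f +S g) k = f k + g k

_*S_ : Series → Series → Series
(f *S g) k = sumTo k (λ i → f i * g (k ℕ.∸ i))

_^S_ : Series → ℕ → Series
f ^S zero = oneS
f ^S suc m = f *S (f ^S m)

xDeriv : Series → Series
xDeriv f k = ℕ→ℚ k * f k

-- multiplicative inverse of a series f with constant term 1:
-- g₀ = 1,  g_k = - Σ_{i=1}^{k} f_i g_{k-i}.
-- invVec f k = (g_k, g_{k-1}, …, g_0)
invVec : Series → (k : ℕ) → Vec ℚ (suc k)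
invVec f zero = 1ℚ ∷ []
invVec f (suc k) = new ∷ old
  where
  old = invVec f k
  -- lookup old j = g_{k-j};  Σ_{i=1}^{k+1} f_i g_{k+1-i} = Σ_{j=0}^{k} f_{j+1} g_{k-j}
  sumOld : ∀ {m} → ℕ → Vec ℚ m → ℚ
  sumOld j [] = 0ℚ
  sumOld j (g ∷ gs) = f (suc j) * g + sumOld (suc j) gs
  new = - sumOld 0 old

invS : Series → Series
invS f k = Vec.head (invVec f k)

Eser : (ℕ → ℤ) → Series
Eser e zero = 1ℚ
Eser e (suc j) = ℤ→ℚ (e (suc j))

Tser : ℕ → (ℕ → ℤ) → Series
Tser n e zero = 1ℚ
Tser n e (suc k') =
  ((ℤ.+ (n ℕ.+ 1) ℤ.- ℤ.+ k) / (k !)) {{k !≢0}}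
  * sumL (map (λ j → sign j * (((ℤ.+ ((n ℕ.+ j) !)) / ((n ℕ.+ 1) !)) {{(n ℕ.+ 1) !≢0}})
                      * bell k j (λ m → fact m * ℤ→ℚ (e m)))
              (Data.List.drop 1 (upTo (suc k))))
  where k = suc k'

{-# OPTIONS --safe #-}
-- Write E = 1 + U. As U is the exponential generating function of the sequence m!·e_m, the
-- multinomial theorem gives B_{k,j}(1!e_1, 2!e_2, …) = (k!/j!) [x^k] U^j, so the inner sum of T_n
-- is (k!/(n+1)) Σ_j (-1)^j C(n+j, j) [x^k] U^j = (k!/(n+1)) [x^k] E^{-(n+1)}. The last equality is
-- the binomial series of (1 + U)^{-(n+1)}: its partial sum P up to degree N satisfies
-- (1 + U)·xP′ = -(n+1)·P·xU′ up to a term of order N + 1, hence x(E^{n+1}P)′, and with it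
-- E^{n+1}P - 1, vanishes below degree N + 1. Finally x(E^{-(n+1)})′ = -(n+1) E^{-(n+2)}·xE′ shows
-- [x^k] E^{-(n+2)}(E + xE′) = (1 - k/(n+1)) [x^k] E^{-(n+1)}, the coefficient of T_n.
module Submission where

open import Defs

module RationalArithmetic where

  open import Data.Nat as ℕ using (ℕ; suc; NonZero; _!; _≤_; _∸_)
  open import Data.Nat.Properties as ℕ using (_!≢0; _!*_!≢0)
  open import Data.Nat.Combinatorics using (_C_; nCk≡n!/k![n-k]!; k![n∸k]!∣n!)
  open import Data.Nat.DivMod using (m/n*n≡m)
  open import Data.Integer as ℤ using (ℤ)
  import Data.Integer.Properties as ℤ
  open import Data.Rational using (ℚ; _/_; _+_; _*_; -_; 0ℚ; 1ℚ; toℚᵘ)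
  open import Data.Rational.Properties
  open import Data.Rational.Unnormalised as ℚᵘ using (ℚᵘ; mkℚᵘ; *≡*; _≃_)
  import Data.Rational.Unnormalised.Properties as ℚᵘ
  open import Data.Rational.Solver using (module +-*-Solver)
  open import Relation.Binary.PropositionalEquality
  open ≡-Reasoning

  1/ℕ : (d : ℕ) → .{{NonZero d}} → ℚ
  1/ℕ d = ℤ.+ 1 / d

  private
    toℚᵘ-/ : ∀ z d → toℚᵘ (z / suc d) ≃ mkℚᵘ z d
    toℚᵘ-/ z d = toℚᵘ-fromℚᵘ (mkℚᵘ z d)

    ≡-viaℚᵘ : ∀ {p q : ℚ} (a b : ℚᵘ) → toℚᵘ p ≃ a → toℚᵘ q ≃ b → a ≃ b → p ≡ q
    ≡-viaℚᵘ a b pa qb ab = toℚᵘ-injective (ℚᵘ.≃-trans pa (ℚᵘ.≃-trans ab (ℚᵘ.≃-sym qb)))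

  ℤ→ℚ-homo-+ : ∀ a b → ℤ→ℚ (a ℤ.+ b) ≡ ℤ→ℚ a + ℤ→ℚ b
  ℤ→ℚ-homo-+ a b = ≡-viaℚᵘ (mkℚᵘ (a ℤ.+ b) 0) (mkℚᵘ a 0 ℚᵘ.+ mkℚᵘ b 0) (toℚᵘ-/ _ 0)
    (ℚᵘ.≃-trans (toℚᵘ-homo-+ (ℤ→ℚ a) (ℤ→ℚ b)) (ℚᵘ.+-cong (toℚᵘ-/ a 0) (toℚᵘ-/ b 0)))
    (*≡* (trans (ℤ.*-identityʳ _)
      (sym (trans (ℤ.*-identityʳ _) (cong₂ ℤ._+_ (ℤ.*-identityʳ a) (ℤ.*-identityʳ b))))))

  ℤ→ℚ-homo-* : ∀ a b → ℤ→ℚ (a ℤ.* b) ≡ ℤ→ℚ a * ℤ→ℚ b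
  ℤ→ℚ-homo-* a b = ≡-viaℚᵘ (mkℚᵘ (a ℤ.* b) 0) (mkℚᵘ a 0 ℚᵘ.* mkℚᵘ b 0) (toℚᵘ-/ _ 0)
    (ℚᵘ.≃-trans (toℚᵘ-homo-* (ℤ→ℚ a) (ℤ→ℚ b)) (ℚᵘ.*-cong (toℚᵘ-/ a 0) (toℚᵘ-/ b 0)))
    (*≡* refl)

  ℤ→ℚ-homo‿- : ∀ a → ℤ→ℚ (ℤ.- a) ≡ - ℤ→ℚ a
  ℤ→ℚ-homo‿- a = ≡-viaℚᵘ (mkℚᵘ (ℤ.- a) 0) (ℚᵘ.- mkℚᵘ a 0) (toℚᵘ-/ _ 0)
    (ℚᵘ.≃-trans (toℚᵘ-homo‿- (ℤ→ℚ a)) (ℚᵘ.-‿cong (toℚᵘ-/ a 0)))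
    (*≡* refl)

  ℕ→ℚ-homo-+ : ∀ a b → ℕ→ℚ (a ℕ.+ b) ≡ ℕ→ℚ a + ℕ→ℚ b
  ℕ→ℚ-homo-+ a b = ℤ→ℚ-homo-+ (ℤ.+ a) (ℤ.+ b)

  ℕ→ℚ-homo-* : ∀ a b → ℕ→ℚ (a ℕ.* b) ≡ ℕ→ℚ a * ℕ→ℚ b
  ℕ→ℚ-homo-* a b = trans (cong ℤ→ℚ (sym (ℤ.+◃n≡+n (a ℕ.* b)))) (ℤ→ℚ-homo-* (ℤ.+ a) (ℤ.+ b))

  /-as-* : ∀ z d .{{_ : NonZero d}} → z / d ≡ ℤ→ℚ z * 1/ℕ d
  /-as-* z (suc d) = ≡-viaℚᵘ (mkℚᵘ z d) (mkℚᵘ z 0 ℚᵘ.* mkℚᵘ (ℤ.+ 1) d) (toℚᵘ-/ z d)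
    (ℚᵘ.≃-trans (toℚᵘ-homo-* (ℤ→ℚ z) (1/ℕ (suc d))) (ℚᵘ.*-cong (toℚᵘ-/ z 0) (toℚᵘ-/ (ℤ.+ 1) d)))
    (*≡* (cong₂ ℤ._*_ (sym (ℤ.*-identityʳ z)) (cong (λ m → ℤ.+ suc m) (ℕ.+-identityʳ d))))

  1/ℕ-inverseˡ : ∀ d .{{_ : NonZero d}} → 1/ℕ d * ℕ→ℚ d ≡ 1ℚ
  1/ℕ-inverseˡ (suc d) = ≡-viaℚᵘ (mkℚᵘ (ℤ.+ 1) d ℚᵘ.* mkℚᵘ (ℤ.+ suc d) 0) (mkℚᵘ (ℤ.+ 1) 0)
    (ℚᵘ.≃-trans (toℚᵘ-homo-* (1/ℕ (suc d)) (ℕ→ℚ (suc d))) (ℚᵘ.*-cong (toℚᵘ-/ (ℤ.+ 1) d) (toℚᵘ-/ (ℤ.+ suc d) 0)))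
    (toℚᵘ-/ _ 0)
    (*≡* (cong (λ m → ℤ.+ suc m) (trans (trans (ℕ.*-identityʳ (d ℕ.+ 0)) (ℕ.+-identityʳ d))
      (sym (trans (ℕ.+-identityʳ (d ℕ.* 1)) (ℕ.*-identityʳ d))))))

  1/ℕ-inverseʳ : ∀ d .{{_ : NonZero d}} → ℕ→ℚ d * 1/ℕ d ≡ 1ℚ
  1/ℕ-inverseʳ d = trans (*-comm (ℕ→ℚ d) (1/ℕ d)) (1/ℕ-inverseˡ d)

  1/ℕ-homo-* : ∀ a b .{{_ : NonZero a}} .{{_ : NonZero b}} →
               1/ℕ (a ℕ.* b) {{ℕ.m*n≢0 a b}} ≡ 1/ℕ a * 1/ℕ b
  1/ℕ-homo-* (suc a) (suc b) =
    ≡-viaℚᵘ (mkℚᵘ (ℤ.+ 1) (b ℕ.+ a ℕ.* suc b)) (mkℚᵘ (ℤ.+ 1) a ℚᵘ.* mkℚᵘ (ℤ.+ 1) b)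
    (toℚᵘ-/ (ℤ.+ 1) (b ℕ.+ a ℕ.* suc b))
    (ℚᵘ.≃-trans (toℚᵘ-homo-* (1/ℕ (suc a)) (1/ℕ (suc b))) (ℚᵘ.*-cong (toℚᵘ-/ (ℤ.+ 1) a) (toℚᵘ-/ (ℤ.+ 1) b)))
    (*≡* refl)

  n*q≡0⇒q≡0 : ∀ d q .{{_ : NonZero d}} → ℕ→ℚ d * q ≡ 0ℚ → q ≡ 0ℚ
  n*q≡0⇒q≡0 d q dq≡0 = begin
    q                      ≡⟨ sym (*-identityˡ q) ⟩
    1ℚ * q                 ≡⟨ cong (_* q) (sym (1/ℕ-inverseˡ d)) ⟩
    (1/ℕ d * ℕ→ℚ d) * q   ≡⟨ *-assoc (1/ℕ d) (ℕ→ℚ d) q ⟩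
    1/ℕ d * (ℕ→ℚ d * q)   ≡⟨ cong (1/ℕ d *_) dq≡0 ⟩
    1/ℕ d * 0ℚ             ≡⟨ *-zeroʳ (1/ℕ d) ⟩
    0ℚ ∎

  fact-suc : ∀ m → fact (suc m) ≡ ℕ→ℚ (suc m) * fact m
  fact-suc m = ℕ→ℚ-homo-* (suc m) (m !)

  invFact-suc : ∀ m → invFact (suc m) ≡ 1/ℕ (suc m) * invFact m
  invFact-suc m = 1/ℕ-homo-* (suc m) (m !) {{_}} {{m !≢0}}

  invFact-inverseˡ : ∀ m → invFact m * fact m ≡ 1ℚ
  invFact-inverseˡ m = 1/ℕ-inverseˡ (m !) {{m !≢0}}

  invFact-inverseʳ : ∀ m → fact m * invFact m ≡ 1ℚ
  invFact-inverseʳ m = trans (*-comm (fact m) (invFact m)) (invFact-inverseˡ m)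

  invFact*C≡invFact*invFact : ∀ a i → i ≤ a → invFact a * ℕ→ℚ (a C i) ≡ invFact i * invFact (a ∸ i)
  invFact*C≡invFact*invFact a i i≤a = begin
    Ia * Cq
      ≡⟨ sym (trans (cong (Ia * Cq *_) (cong₂ _*_ (invFact-inverseʳ i) (invFact-inverseʳ (a ∸ i))))
                    (trans (cong (Ia * Cq *_) (*-identityˡ 1ℚ)) (*-identityʳ (Ia * Cq)))) ⟩
    Ia * Cq * ((Fi * Ii) * (Fj * Ij))
      ≡⟨ solve 6 (λ Ia Cq Fi Ii Fj Ij → Ia :* Cq :* ((Fi :* Ii) :* (Fj :* Ij)) := (Ia :* (Cq :* (Fi :* Fj))) :* (Ii :* Ij))
           refl Ia Cq Fi Ii Fj Ij ⟩
    (Ia * (Cq * (Fi * Fj))) * (Ii * Ij)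
      ≡⟨ cong (λ t → (Ia * t) * (Ii * Ij)) (begin
           Cq * (Fi * Fj)                         ≡⟨ cong (Cq *_) (sym (ℕ→ℚ-homo-* (i !) ((a ∸ i) !))) ⟩
           Cq * ℕ→ℚ (i ! ℕ.* (a ∸ i) !)           ≡⟨ sym (ℕ→ℚ-homo-* (a C i) (i ! ℕ.* (a ∸ i) !)) ⟩
           ℕ→ℚ ((a C i) ℕ.* (i ! ℕ.* (a ∸ i) !)) ≡⟨ cong ℕ→ℚ C*k!*[n∸k]!≡n! ⟩
           fact a                                ∎) ⟩
    (Ia * fact a) * (Ii * Ij)
      ≡⟨ trans (cong (_* (Ii * Ij)) (invFact-inverseˡ a)) (*-identityˡ (Ii * Ij)) ⟩
    Ii * Ij ∎
    where
    open +-*-Solver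
    Ia = invFact a
    Cq = ℕ→ℚ (a C i)
    Ii = invFact i
    Ij = invFact (a ∸ i)
    Fi = fact i
    Fj = fact (a ∸ i)
    C*k!*[n∸k]!≡n! : (a C i) ℕ.* (i ! ℕ.* (a ∸ i) !) ≡ a !
    C*k!*[n∸k]!≡n! = trans (cong (ℕ._* (i ! ℕ.* (a ∸ i) !)) (nCk≡n!/k![n-k]! i≤a))
                           (m/n*n≡m {{i !* (a ∸ i) !≢0}} (k![n∸k]!∣n! i≤a))

module FiniteSums where

  open RationalArithmetic
  open import Data.Nat as ℕ using (ℕ; zero; suc; _≤_; _<_; _∸_; z≤n; s≤s)
  import Data.Nat.Properties as ℕ
  open import Data.Rational using (ℚ; _+_; _*_; 0ℚ)
  open import Data.Rational.Properties
  open import Data.Rational.Solver using (module +-*-Solver)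
  open import Data.List using ([]; _∷_; map; applyUpTo)
  open import Data.Empty using (⊥-elim)
  open import Data.Sum using (inj₁; inj₂)
  open import Function using (_∘_)
  open import Relation.Nullary using (Dec; yes; no; ¬_)
  open import Relation.Binary.PropositionalEquality
  open ≡-Reasoning

  sumTo-cong≤ : ∀ k {f g : ℕ → ℚ} → (∀ i → i ≤ k → f i ≡ g i) → sumTo k f ≡ sumTo k g
  sumTo-cong≤ zero f≗g = f≗g 0 z≤n
  sumTo-cong≤ (suc k) f≗g =
    cong₂ _+_ (sumTo-cong≤ k (λ i i≤k → f≗g i (ℕ.m≤n⇒m≤1+n i≤k))) (f≗g (suc k) ℕ.≤-refl)

  sumTo-cong : ∀ k {f g : ℕ → ℚ} → (∀ i → f i ≡ g i) → sumTo k f ≡ sumTo k g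
  sumTo-cong k f≗g = sumTo-cong≤ k (λ i _ → f≗g i)

  sumTo-zero : ∀ k (f : ℕ → ℚ) → (∀ i → i ≤ k → f i ≡ 0ℚ) → sumTo k f ≡ 0ℚ
  sumTo-zero zero f f≡0 = f≡0 0 z≤n
  sumTo-zero (suc k) f f≡0 = trans
    (cong₂ _+_ (sumTo-zero k f (λ i i≤k → f≡0 i (ℕ.m≤n⇒m≤1+n i≤k))) (f≡0 (suc k) ℕ.≤-refl))
    (+-identityʳ 0ℚ)

  sumTo-+ : ∀ k (f g : ℕ → ℚ) → sumTo k (λ i → f i + g i) ≡ sumTo k f + sumTo k g
  sumTo-+ zero f g = refl
  sumTo-+ (suc k) f g = trans (cong (_+ (f (suc k) + g (suc k))) (sumTo-+ k f g))
    (solve 4 (λ a b c d → (a :+ b) :+ (c :+ d) := (a :+ c) :+ (b :+ d)) refl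
      (sumTo k f) (sumTo k g) (f (suc k)) (g (suc k)))
    where open +-*-Solver

  *-distribˡ-sumTo : ∀ k c (f : ℕ → ℚ) → c * sumTo k f ≡ sumTo k (λ i → c * f i)
  *-distribˡ-sumTo zero c f = refl
  *-distribˡ-sumTo (suc k) c f = trans (*-distribˡ-+ c (sumTo k f) (f (suc k)))
    (cong (_+ (c * f (suc k))) (*-distribˡ-sumTo k c f))

  *-distribʳ-sumTo : ∀ k c (f : ℕ → ℚ) → sumTo k f * c ≡ sumTo k (λ i → f i * c)
  *-distribʳ-sumTo zero c f = refl
  *-distribʳ-sumTo (suc k) c f = trans (*-distribʳ-+ c (sumTo k f) (f (suc k)))
    (cong (_+ (f (suc k) * c)) (*-distribʳ-sumTo k c f))

  sumTo-suc : ∀ k (f : ℕ → ℚ) → sumTo (suc k) f ≡ f 0 + sumTo k (f ∘ suc)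
  sumTo-suc zero f = refl
  sumTo-suc (suc k) f = trans (cong (_+ f (suc (suc k))) (sumTo-suc k f))
    (+-assoc (f 0) (sumTo k (f ∘ suc)) (f (suc (suc k))))

  sumTo-reverse : ∀ k (f : ℕ → ℚ) → sumTo k f ≡ sumTo k (λ i → f (k ∸ i))
  sumTo-reverse zero f = refl
  sumTo-reverse (suc k) f = begin
    sumTo k f + f (suc k)                   ≡⟨ +-comm (sumTo k f) (f (suc k)) ⟩
    f (suc k) + sumTo k f                   ≡⟨ cong (f (suc k) +_) (sumTo-reverse k f) ⟩
    f (suc k) + sumTo k (λ i → f (k ∸ i))   ≡⟨ sym (sumTo-suc k (λ i → f (suc k ∸ i))) ⟩
    sumTo (suc k) (λ i → f (suc k ∸ i))     ∎

  sumTo-comm : ∀ a b (G : ℕ → ℕ → ℚ) →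
               sumTo a (λ i → sumTo b (G i)) ≡ sumTo b (λ j → sumTo a (λ i → G i j))
  sumTo-comm zero b G = refl
  sumTo-comm (suc a) b G = trans (cong (_+ sumTo b (G (suc a))) (sumTo-comm a b G))
    (sym (sumTo-+ b (λ j → sumTo a (λ i → G i j)) (G (suc a))))

  sumTo-triangle : ∀ k (F : ℕ → ℕ → ℚ) →
    sumTo k (λ p → sumTo p (λ i → F i p)) ≡ sumTo k (λ i → sumTo (k ∸ i) (λ j → F i (i ℕ.+ j)))
  sumTo-triangle zero F = refl
  sumTo-triangle (suc k) F = begin
    sumTo k (λ p → sumTo p (λ i → F i p)) + sumTo (suc k) (λ i → F i (suc k))
      ≡⟨ cong (_+ sumTo (suc k) (λ i → F i (suc k))) (sumTo-triangle k F) ⟩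
    Rows k + (sumTo k (λ i → F i (suc k)) + F (suc k) (suc k))
      ≡⟨ sym (+-assoc (Rows k) (sumTo k (λ i → F i (suc k))) (F (suc k) (suc k))) ⟩
    (Rows k + sumTo k (λ i → F i (suc k))) + F (suc k) (suc k)
      ≡⟨ cong (_+ F (suc k) (suc k)) (sym (sumTo-+ k _ _)) ⟩
    sumTo k (λ i → sumTo (k ∸ i) (λ j → F i (i ℕ.+ j)) + F i (suc k)) + F (suc k) (suc k)
      ≡⟨ cong₂ _+_ (sumTo-cong≤ k extend-row) last-row ⟩
    Rows (suc k) ∎
    where
    Rows : ℕ → ℚ
    Rows k = sumTo k (λ i → sumTo (k ∸ i) (λ j → F i (i ℕ.+ j)))
    last-row : F (suc k) (suc k) ≡ sumTo (k ∸ k) (λ j → F (suc k) (suc k ℕ.+ j))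
    last-row rewrite ℕ.n∸n≡0 k | ℕ.+-identityʳ k = refl
    extend-row : ∀ i → i ≤ k → sumTo (k ∸ i) (λ j → F i (i ℕ.+ j)) + F i (suc k)
                                 ≡ sumTo (suc k ∸ i) (λ j → F i (i ℕ.+ j))
    extend-row i i≤k rewrite ℕ.+-∸-assoc 1 i≤k =
      cong (λ m → sumTo (k ∸ i) (λ j → F i (i ℕ.+ j)) + F i m)
        (sym (trans (ℕ.+-suc i (k ∸ i)) (cong suc (ℕ.m+[n∸m]≡n i≤k))))

  sumTo-extend : ∀ k m (f : ℕ → ℚ) → (∀ i → k < i → f i ≡ 0ℚ) → sumTo (k ℕ.+ m) f ≡ sumTo k f
  sumTo-extend k zero f f≡0 = cong (λ t → sumTo t f) (ℕ.+-identityʳ k)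
  sumTo-extend k (suc m) f f≡0 = trans (cong (λ t → sumTo t f) (ℕ.+-suc k m))
    (trans (cong₂ _+_ (sumTo-extend k m f f≡0) (f≡0 (suc (k ℕ.+ m)) (s≤s (ℕ.m≤m+n k m))))
           (+-identityʳ (sumTo k f)))

  guard : ∀ {P : Set} → Dec P → ℚ → ℚ
  guard (yes _) q = q
  guard (no _)  q = 0ℚ

  guard-yes : ∀ {P : Set} (d : Dec P) q → P → guard d q ≡ q
  guard-yes (yes _) q p = refl
  guard-yes (no ¬p) q p = ⊥-elim (¬p p)

  guard-no : ∀ {P : Set} (d : Dec P) q → ¬ P → guard d q ≡ 0ℚ
  guard-no (yes p) q ¬p = ⊥-elim (¬p p)
  guard-no (no _)  q ¬p = refl

  guard-cong : ∀ {P : Set} (d : Dec P) {q q′} → q ≡ q′ → guard d q ≡ guard d q′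
  guard-cong d refl = refl

  guard-zero : ∀ {P : Set} (d : Dec P) → guard d 0ℚ ≡ 0ℚ
  guard-zero (yes _) = refl
  guard-zero (no _)  = refl

  *-distribˡ-guard : ∀ {P : Set} (d : Dec P) c q → c * guard d q ≡ guard d (c * q)
  *-distribˡ-guard (yes _) c q = refl
  *-distribˡ-guard (no _)  c q = *-zeroʳ c

  sumTo-single : ∀ k d (f : ℕ → ℚ) → (∀ j → j ≢ d → f j ≡ 0ℚ) → sumTo k f ≡ guard (d ℕ.≤? k) (f d)
  sumTo-single zero d f f≡0 with d ℕ.≟ 0
  ... | yes refl = refl
  ... | no d≢0 = trans (f≡0 0 (λ eq → d≢0 (sym eq)))
                       (sym (guard-no (d ℕ.≤? 0) (f d) (λ d≤0 → d≢0 (ℕ.n≤0⇒n≡0 d≤0))))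
  sumTo-single (suc k) d f f≡0 with d ℕ.≤? k
  ... | yes d≤k = begin
    sumTo k f + f (suc k)                ≡⟨ cong₂ _+_ (sumTo-single k d f f≡0)
                                              (f≡0 (suc k) (λ eq → ℕ.<-irrefl (sym eq) (s≤s d≤k))) ⟩
    guard (d ℕ.≤? k) (f d) + 0ℚ          ≡⟨ +-identityʳ _ ⟩
    guard (d ℕ.≤? k) (f d)               ≡⟨ guard-yes (d ℕ.≤? k) (f d) d≤k ⟩
    f d                                  ≡⟨ sym (guard-yes (d ℕ.≤? suc k) (f d) (ℕ.m≤n⇒m≤1+n d≤k)) ⟩
    guard (d ℕ.≤? suc k) (f d)           ∎
  ... | no d≰k with d ℕ.≟ suc k
  ...   | yes refl = begin
    sumTo k f + f (suc k)                ≡⟨ cong (_+ f (suc k)) (trans (sumTo-single k (suc k) f f≡0)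
                                                                  (guard-no (suc k ℕ.≤? k) (f (suc k)) d≰k)) ⟩
    0ℚ + f (suc k)                       ≡⟨ +-identityˡ (f (suc k)) ⟩
    f (suc k)                            ≡⟨ sym (guard-yes (suc k ℕ.≤? suc k) (f (suc k)) ℕ.≤-refl) ⟩
    guard (suc k ℕ.≤? suc k) (f (suc k)) ∎
  ...   | no d≢1+k = begin
    sumTo k f + f (suc k)                ≡⟨ cong₂ _+_ (trans (sumTo-single k d f f≡0) (guard-no (d ℕ.≤? k) (f d) d≰k))
                                                      (f≡0 (suc k) (λ eq → d≢1+k (sym eq))) ⟩
    0ℚ + 0ℚ                              ≡⟨ +-identityʳ 0ℚ ⟩
    0ℚ                                   ≡⟨ sym (guard-no (d ℕ.≤? suc k) (f d) d≰1+k) ⟩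
    guard (d ℕ.≤? suc k) (f d)           ∎
    where
    d≰1+k : ¬ (d ℕ.≤ suc k)
    d≰1+k d≤1+k with ℕ.m≤n⇒m<n∨m≡n d≤1+k
    ... | inj₁ d<1+k = d≰k (ℕ.≤-pred d<1+k)
    ... | inj₂ d≡1+k = d≢1+k d≡1+k

  sumL-map-cong : ∀ {A : Set} {g h : A → ℚ} xs → (∀ v → g v ≡ h v) → sumL (map g xs) ≡ sumL (map h xs)
  sumL-map-cong [] g≗h = refl
  sumL-map-cong (v ∷ xs) g≗h = cong₂ _+_ (g≗h v) (sumL-map-cong xs g≗h)

  sumL-applyUpTo : ∀ (h : ℕ → ℚ) k (f : ℕ → ℕ) → sumL (map h (applyUpTo f (suc k))) ≡ sumTo k (h ∘ f)
  sumL-applyUpTo h zero f = +-identityʳ (h (f 0))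
  sumL-applyUpTo h (suc k) f = trans (cong (h (f 0) +_) (sumL-applyUpTo h k (f ∘ suc)))
    (sym (sumTo-suc k (h ∘ f)))

module PowerSeries where

  open RationalArithmetic
  open FiniteSums
  open import Data.Nat as ℕ using (ℕ; zero; suc; _≤_; _<_; _∸_)
  import Data.Nat.Properties as ℕ
  open import Data.Rational using (ℚ; _+_; _*_; -_; 0ℚ; 1ℚ)
  open import Data.Rational.Properties
  open import Data.Product using (_,_)
  open import Data.Vec using (Vec; []; _∷_)
  open import Data.Fin using (toℕ)
  open import Algebra.Bundles using (CommutativeRing; Semiring)
  import Algebra.Solver.Ring.NaturalCoefficients.Default
  import Algebra.Definitions.RawSemiring
  import Relation.Binary.Reasoning.Setoid
  open import Data.Rational.Solver using (module +-*-Solver)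
  open import Relation.Nullary using (yes; no)
  open import Relation.Binary.Structures using (IsEquivalence)
  open import Relation.Binary.PropositionalEquality

  -- A record rather than a Π-type, so that both series can be inferred from a proof.
  infix 4 _≈S_
  record _≈S_ (f g : Series) : Set where
    constructor mk≈
    field at : ∀ k → f k ≡ g k
  open _≈S_ public

  zeroS : Series
  zeroS _ = 0ℚ

  -S_ : Series → Series
  (-S f) k = - f k

  *S-cong : ∀ {f f′ g g′} → f ≈S f′ → g ≈S g′ → (f *S g) ≈S (f′ *S g′)
  *S-cong f≈f′ g≈g′ = mk≈ λ k → sumTo-cong k (λ i → cong₂ _*_ (at f≈f′ i) (at g≈g′ (k ∸ i)))

  *S-comm : ∀ f g → (f *S g) ≈S (g *S f)
  *S-comm f g = mk≈ λ k → trans (sumTo-reverse k _) (sumTo-cong≤ k (λ i i≤k →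
    trans (cong (λ j → f (k ∸ i) * g j) (ℕ.m∸[m∸n]≡n i≤k)) (*-comm (f (k ∸ i)) (g i))))

  *S-assoc : ∀ f g h → ((f *S g) *S h) ≈S (f *S (g *S h))
  *S-assoc f g h = mk≈ λ k → begin
    sumTo k (λ p → sumTo p (λ i → f i * g (p ∸ i)) * h (k ∸ p))
      ≡⟨ sumTo-cong k (λ p → *-distribʳ-sumTo p (h (k ∸ p)) _) ⟩
    sumTo k (λ p → sumTo p (λ i → f i * g (p ∸ i) * h (k ∸ p)))
      ≡⟨ sumTo-triangle k (λ i p → f i * g (p ∸ i) * h (k ∸ p)) ⟩
    sumTo k (λ i → sumTo (k ∸ i) (λ j → f i * g (i ℕ.+ j ∸ i) * h (k ∸ (i ℕ.+ j))))
      ≡⟨ sumTo-cong k (λ i → trans (sumTo-cong (k ∸ i) (λ j →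
            trans (cong₂ (λ p q → f i * g p * h q) (ℕ.m+n∸m≡n i j) (sym (ℕ.∸-+-assoc k i j)))
                  (*-assoc (f i) _ _)))
          (sym (*-distribˡ-sumTo (k ∸ i) (f i) _))) ⟩
    sumTo k (λ i → f i * sumTo (k ∸ i) (λ j → g j * h (k ∸ i ∸ j))) ∎
    where open ≡-Reasoning

  *S-identityˡ : ∀ f → (oneS *S f) ≈S f
  *S-identityˡ f = mk≈ identityˡ
    where
    identityˡ : ∀ k → (oneS *S f) k ≡ f k
    identityˡ zero = *-identityˡ (f 0)
    identityˡ (suc k) = trans (sumTo-suc k _)
      (trans (cong₂ _+_ (*-identityˡ (f (suc k))) (sumTo-zero k _ (λ i _ → *-zeroˡ (f (suc k ∸ suc i)))))
             (+-identityʳ _))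

  *S-distribˡ-+S : ∀ f g h → (f *S (g +S h)) ≈S ((f *S g) +S (f *S h))
  *S-distribˡ-+S f g h = mk≈ λ k → trans (sumTo-cong k (λ i → *-distribˡ-+ (f i) _ _)) (sumTo-+ k _ _)

  ≈S-isEquivalence : IsEquivalence _≈S_
  ≈S-isEquivalence = record
    { refl  = mk≈ λ k → refl
    ; sym   = λ f≈g → mk≈ λ k → sym (at f≈g k)
    ; trans = λ f≈g g≈h → mk≈ λ k → trans (at f≈g k) (at g≈h k)
    }

  commutativeRing : CommutativeRing _ _
  commutativeRing = record
    { Carrier = Series ; _≈_ = _≈S_ ; _+_ = _+S_ ; _*_ = _*S_ ; -_ = -S_ ; 0# = zeroS ; 1# = oneS
    ; isCommutativeRing = record
      { isRing = record
        { +-isAbelianGroup = record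
          { isGroup = record
            { isMonoid = record
              { isSemigroup = record
                { isMagma = record
                  { isEquivalence = ≈S-isEquivalence
                  ; ∙-cong = λ f≈f′ g≈g′ → mk≈ λ k → cong₂ _+_ (at f≈f′ k) (at g≈g′ k) }
                ; assoc = λ f g h → mk≈ λ k → +-assoc (f k) (g k) (h k) }
              ; identity = (λ f → mk≈ λ k → +-identityˡ (f k)) , (λ f → mk≈ λ k → +-identityʳ (f k)) }
            ; inverse = (λ f → mk≈ λ k → +-inverseˡ (f k)) , (λ f → mk≈ λ k → +-inverseʳ (f k))
            ; ⁻¹-cong = λ f≈g → mk≈ λ k → cong -_ (at f≈g k) }
          ; comm = λ f g → mk≈ λ k → +-comm (f k) (g k) }
        ; *-cong = *S-cong
        ; *-assoc = *S-assoc
        ; *-identity = *S-identityˡ , λ f → ≈-trans (*S-comm f oneS) (*S-identityˡ f)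
        ; distrib = *S-distribˡ-+S , λ f g h →
            ≈-trans (*S-comm (g +S h) f) (≈-trans (*S-distribˡ-+S f g h)
              (mk≈ λ k → cong₂ _+_ (at (*S-comm f g) k) (at (*S-comm f h) k))) }
      ; *-comm = *S-comm } }
    where open IsEquivalence ≈S-isEquivalence renaming (trans to ≈-trans)

  module R = CommutativeRing commutativeRing
  module RingSolver = Algebra.Solver.Ring.NaturalCoefficients.Default R.commutativeSemiring
  module ≈S-Reasoning = Relation.Binary.Reasoning.Setoid R.setoid
  open Algebra.Definitions.RawSemiring (Semiring.rawSemiring R.semiring) public using (_^_; _×_) renaming (sum to ∑)

  +S-congˡ : ∀ f {g h} → g ≈S h → (f +S g) ≈S (f +S h)
  +S-congˡ f = R.+-congˡ {f}

  +S-congʳ : ∀ {f g} h → f ≈S g → (f +S h) ≈S (g +S h)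
  +S-congʳ h = R.+-congʳ {h}

  *S-congˡ : ∀ f {g h} → g ≈S h → (f *S g) ≈S (f *S h)
  *S-congˡ f = R.*-congˡ {f}

  *S-congʳ : ∀ {f g} h → f ≈S g → (f *S h) ≈S (g *S h)
  *S-congʳ h = R.*-congʳ {h}

  constS : ℚ → Series
  constS c zero    = c
  constS c (suc _) = 0ℚ

  constS-*S : ∀ c f → (constS c *S f) ≈S (λ k → c * f k)
  constS-*S c f = mk≈ scale
    where
    scale : ∀ k → (constS c *S f) k ≡ c * f k
    scale zero = refl
    scale (suc k) = trans (sumTo-suc k (λ i → constS c i * f (suc k ∸ i)))
      (trans (cong (c * f (suc k) +_) (sumTo-zero k _ (λ i _ → *-zeroˡ (f (suc k ∸ suc i)))))
             (+-identityʳ (c * f (suc k))))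

  constS-cong : ∀ {a b} → a ≡ b → constS a ≈S constS b
  constS-cong refl = R.refl

  constS-one : constS 1ℚ ≈S oneS
  constS-one = mk≈ λ { zero → refl ; (suc k) → refl }

  constS-homo-+ : ∀ a b → constS (a + b) ≈S (constS a +S constS b)
  constS-homo-+ a b = mk≈ λ { zero → refl ; (suc k) → sym (+-identityʳ 0ℚ) }

  constS-*S-constS : ∀ c d f → (constS c *S (constS d *S f)) ≈S (constS (c * d) *S f)
  constS-*S-constS c d f = mk≈ λ k → begin
    (constS c *S (constS d *S f)) k ≡⟨ at (constS-*S c (constS d *S f)) k ⟩
    c * (constS d *S f) k           ≡⟨ cong (c *_) (at (constS-*S d f) k) ⟩
    c * (d * f k)                   ≡⟨ sym (*-assoc c d (f k)) ⟩
    c * d * f k                     ≡⟨ sym (at (constS-*S (c * d) f) k) ⟩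
    (constS (c * d) *S f) k         ∎
    where open ≡-Reasoning

  constS-zero : ∀ {c} f → c ≡ 0ℚ → (constS c *S f) ≈S zeroS
  constS-zero f refl = mk≈ λ k → trans (at (constS-*S 0ℚ f) k) (*-zeroˡ (f k))

  xDeriv-cong : ∀ {f g} → f ≈S g → xDeriv f ≈S xDeriv g
  xDeriv-cong f≈g = mk≈ λ k → cong (ℕ→ℚ k *_) (at f≈g k)

  xDeriv-+S : ∀ f g → xDeriv (f +S g) ≈S (xDeriv f +S xDeriv g)
  xDeriv-+S f g = mk≈ λ k → *-distribˡ-+ (ℕ→ℚ k) (f k) (g k)

  xDeriv-*S : ∀ f g → xDeriv (f *S g) ≈S ((xDeriv f *S g) +S (f *S xDeriv g))
  xDeriv-*S f g = mk≈ λ k → trans (*-distribˡ-sumTo k (ℕ→ℚ k) _) (trans (sumTo-cong≤ k (leibniz k)) (sumTo-+ k _ _))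
    where
    leibniz : ∀ k i → i ≤ k → ℕ→ℚ k * (f i * g (k ∸ i)) ≡ ℕ→ℚ i * f i * g (k ∸ i) + f i * (ℕ→ℚ (k ∸ i) * g (k ∸ i))
    leibniz k i i≤k = trans
      (cong (λ t → t * (f i * g (k ∸ i))) (trans (cong ℕ→ℚ (sym (ℕ.m+[n∸m]≡n i≤k))) (ℕ→ℚ-homo-+ i (k ∸ i))))
      (solve 4 (λ a b c d → (a :+ b) :* (c :* d) := a :* c :* d :+ c :* (b :* d)) refl
        (ℕ→ℚ i) (ℕ→ℚ (k ∸ i)) (f i) (g (k ∸ i)))
      where open +-*-Solver

  xDeriv-oneS : xDeriv oneS ≈S zeroS
  xDeriv-oneS = mk≈ λ { zero → *-zeroˡ 1ℚ ; (suc k) → *-zeroʳ (ℕ→ℚ (suc k)) }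

  xDeriv-constS-*S : ∀ c f → xDeriv (constS c *S f) ≈S (constS c *S xDeriv f)
  xDeriv-constS-*S c f = mk≈ λ k → begin
    ℕ→ℚ k * (constS c *S f) k   ≡⟨ cong (ℕ→ℚ k *_) (at (constS-*S c f) k) ⟩
    ℕ→ℚ k * (c * f k)           ≡⟨ solve 3 (λ K c x → K :* (c :* x) := c :* (K :* x)) refl (ℕ→ℚ k) c (f k) ⟩
    c * (ℕ→ℚ k * f k)           ≡⟨ sym (at (constS-*S c (xDeriv f)) k) ⟩
    (constS c *S xDeriv f) k    ∎
    where open ≡-Reasoning
          open +-*-Solver

  xDeriv-^S : ∀ f m → xDeriv (f ^S suc m) ≈S (constS (ℕ→ℚ (suc m)) *S ((f ^S m) *S xDeriv f))
  xDeriv-^S f zero = begin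
    xDeriv (f *S oneS)                        ≈⟨ xDeriv-*S f oneS ⟩
    (xDeriv f *S oneS) +S (f *S xDeriv oneS)  ≈⟨ +S-congˡ (xDeriv f *S oneS) (*S-congˡ f xDeriv-oneS) ⟩
    (xDeriv f *S oneS) +S (f *S zeroS)
      ≈⟨ solve 2 (λ X F → X :* con 1 :+ F :* con 0 := con 1 :* (con 1 :* X)) R.refl (xDeriv f) f ⟩
    oneS *S (oneS *S xDeriv f)                ≈⟨ *S-congʳ (oneS *S xDeriv f) (R.sym constS-one) ⟩
    constS 1ℚ *S (oneS *S xDeriv f)           ∎
    where open ≈S-Reasoning
          open RingSolver
  xDeriv-^S f (suc m) = begin
    xDeriv (f *S (f ^S suc m))
      ≈⟨ xDeriv-*S f (f ^S suc m) ⟩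
    (xDeriv f *S (f *S (f ^S m))) +S (f *S xDeriv (f ^S suc m))
      ≈⟨ +S-congˡ (xDeriv f *S (f *S (f ^S m))) (*S-congˡ f (xDeriv-^S f m)) ⟩
    (xDeriv f *S (f *S (f ^S m))) +S (f *S (C *S ((f ^S m) *S xDeriv f)))
      ≈⟨ solve 4 (λ X F G C → X :* (F :* G) :+ F :* (C :* (G :* X)) := (con 1 :+ C) :* ((F :* G) :* X))
           R.refl (xDeriv f) f (f ^S m) C ⟩
    (oneS +S C) *S ((f *S (f ^S m)) *S xDeriv f)
      ≈⟨ *S-congʳ ((f *S (f ^S m)) *S xDeriv f) (R.trans (+S-congʳ C (R.sym constS-one))
           (R.trans (R.sym (constS-homo-+ 1ℚ (ℕ→ℚ (suc m)))) (constS-cong (sym (ℕ→ℚ-homo-+ 1 (suc m)))))) ⟩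
    constS (ℕ→ℚ (suc (suc m))) *S ((f *S (f ^S m)) *S xDeriv f) ∎
    where open ≈S-Reasoning
          open RingSolver
          C = constS (ℕ→ℚ (suc m))

  OrderAtLeast : ℕ → Series → Set
  OrderAtLeast d f = ∀ i → i < d → f i ≡ 0ℚ

  order-*S : ∀ a b f g → OrderAtLeast a f → OrderAtLeast b g → OrderAtLeast (a ℕ.+ b) (f *S g)
  order-*S a b f g ord-f ord-g k k<a+b = sumTo-zero k _ term≡0
    where
    term≡0 : ∀ i → i ≤ k → f i * g (k ∸ i) ≡ 0ℚ
    term≡0 i i≤k with i ℕ.<? a
    ... | yes i<a = trans (cong (_* g (k ∸ i)) (ord-f i i<a)) (*-zeroˡ (g (k ∸ i)))
    ... | no i≮a = trans (cong (f i *_) (ord-g (k ∸ i) k∸i<b)) (*-zeroʳ (f i))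
      where
      k∸i<b : k ∸ i < b
      k∸i<b = ℕ.+-cancelˡ-< i (k ∸ i) b (subst (ℕ._< i ℕ.+ b) (sym (ℕ.m+[n∸m]≡n i≤k))
                (ℕ.<-≤-trans k<a+b (ℕ.+-monoˡ-≤ b (ℕ.≮⇒≥ i≮a))))

  order-^S : ∀ f → OrderAtLeast 1 f → ∀ j → OrderAtLeast j (f ^S j)
  order-^S f ord-f zero i ()
  order-^S f ord-f (suc j) = order-*S 1 j f (f ^S j) ord-f (order-^S f ord-f j)

  ^S-cong : ∀ {f g} j → f ≈S g → (f ^S j) ≈S (g ^S j)
  ^S-cong zero f≈g = R.refl
  ^S-cong (suc j) f≈g = *S-cong f≈g (^S-cong j f≈g)

  oneS-^S : ∀ j → (oneS ^S j) ≈S oneS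
  oneS-^S zero = R.refl
  oneS-^S (suc j) = R.trans (*S-congˡ oneS (oneS-^S j)) (*S-identityˡ oneS)

  ^S-distrib-*S : ∀ f g j → ((f *S g) ^S j) ≈S ((f ^S j) *S (g ^S j))
  ^S-distrib-*S f g zero = R.sym (*S-identityˡ oneS)
  ^S-distrib-*S f g (suc j) = R.trans (*S-congˡ (f *S g) (^S-distrib-*S f g j))
    (solve 4 (λ F G A B → (F :* G) :* (A :* B) := (F :* A) :* (G :* B)) R.refl f g (f ^S j) (g ^S j))
    where open RingSolver

  ^S-constant : ∀ f → f 0 ≡ 1ℚ → ∀ j → (f ^S j) 0 ≡ 1ℚ
  ^S-constant f f₀≡1 zero = refl
  ^S-constant f f₀≡1 (suc j) = trans (cong₂ _*_ f₀≡1 (^S-constant f f₀≡1 j)) (*-identityˡ 1ℚ)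

  sumS : ℕ → (ℕ → Series) → Series
  sumS N F k = sumTo N (λ j → F j k)

  sumS-cong : ∀ N {F G : ℕ → Series} → (∀ j → F j ≈S G j) → sumS N F ≈S sumS N G
  sumS-cong N F≈G = mk≈ λ k → sumTo-cong N (λ j → at (F≈G j) k)

  sumS-+S : ∀ N F G → sumS N (λ j → F j +S G j) ≈S (sumS N F +S sumS N G)
  sumS-+S N F G = mk≈ λ k → sumTo-+ N (λ j → F j k) (λ j → G j k)

  sumS-suc : ∀ N F → sumS (suc N) F ≈S (F 0 +S sumS N (λ j → F (suc j)))
  sumS-suc N F = mk≈ λ k → sumTo-suc N (λ j → F j k)

  *S-distribˡ-sumS : ∀ f N F → (f *S sumS N F) ≈S sumS N (λ j → f *S F j)
  *S-distribˡ-sumS f N F = mk≈ λ k → trans (sumTo-cong k (λ i → *-distribˡ-sumTo N (f i) (λ j → F j (k ∸ i))))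
    (sumTo-comm k N (λ i j → f i * F j (k ∸ i)))

  *S-distribʳ-sumS : ∀ f N F → (sumS N F *S f) ≈S sumS N (λ j → F j *S f)
  *S-distribʳ-sumS f N F =
    R.trans (*S-comm (sumS N F) f) (R.trans (*S-distribˡ-sumS f N F) (sumS-cong N (λ j → *S-comm f (F j))))

  xDeriv-sumS : ∀ N F → xDeriv (sumS N F) ≈S sumS N (λ j → xDeriv (F j))
  xDeriv-sumS N F = mk≈ λ k → *-distribˡ-sumTo N (ℕ→ℚ k) (λ j → F j k)

  weightedSum : Series → ∀ {m} → ℕ → Vec ℚ m → ℚ
  weightedSum f j []       = 0ℚ
  weightedSum f j (g ∷ gs) = f (suc j) * g + weightedSum f (suc j) gs

  weightedSum-unique : ∀ f {h : ∀ {m} → ℕ → Vec ℚ m → ℚ} → (∀ j → h j [] ≡ 0ℚ) →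
    (∀ {m} j g (gs : Vec ℚ m) → h j (g ∷ gs) ≡ f (suc j) * g + h (suc j) gs) →
    ∀ {m} j (v : Vec ℚ m) → h j v ≡ weightedSum f j v
  weightedSum-unique f h-[] h-∷ j [] = h-[] j
  weightedSum-unique f {h} h-[] h-∷ j (g ∷ v) =
    trans (h-∷ j g v) (cong (f (suc j) * g +_) (weightedSum-unique f {h} h-[] h-∷ (suc j) v))

  -- The accumulator of invVec is local to Defs: abstracting over its arguments
  -- lets unification recover it from its defining equations.
  invS-suc : ∀ f k → invS f (suc k) ≡ - weightedSum f 0 (invVec f k)
  invS-suc f k with weightedSum-unique f (λ _ → refl) (λ _ _ _ → refl) | suc k | 0 | invVec f k
  ... | unique | m | j | v = cong -_ (unique j v)

  weightedSum-invVec : ∀ f k j →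
    weightedSum f j (invVec f k) ≡ sumTo k (λ i → f (suc (j ℕ.+ i)) * invS f (k ∸ i))
  weightedSum-invVec f zero j = trans (+-identityʳ _) (cong (λ t → f (suc t) * 1ℚ) (sym (ℕ.+-identityʳ j)))
  weightedSum-invVec f (suc k) j = begin
    f (suc j) * invS f (suc k) + weightedSum f (suc j) (invVec f k)
      ≡⟨ cong (f (suc j) * invS f (suc k) +_) (weightedSum-invVec f k (suc j)) ⟩
    f (suc j) * invS f (suc k) + sumTo k (λ i → f (suc (suc j ℕ.+ i)) * invS f (k ∸ i))
      ≡⟨ cong₂ _+_ (cong (λ t → f (suc t) * invS f (suc k)) (sym (ℕ.+-identityʳ j)))
                   (sumTo-cong k (λ i → cong (λ t → f (suc t) * invS f (k ∸ i)) (sym (ℕ.+-suc j i)))) ⟩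
    f (suc (j ℕ.+ 0)) * invS f (suc k) + sumTo k (λ i → f (suc (j ℕ.+ suc i)) * invS f (k ∸ i))
      ≡⟨ sym (sumTo-suc k (λ i → f (suc (j ℕ.+ i)) * invS f (suc k ∸ i))) ⟩
    sumTo (suc k) (λ i → f (suc (j ℕ.+ i)) * invS f (suc k ∸ i)) ∎
    where open ≡-Reasoning

  invS-inverseʳ : ∀ f → f 0 ≡ 1ℚ → (f *S invS f) ≈S oneS
  invS-inverseʳ f f₀≡1 = mk≈ inverse
    where
    open ≡-Reasoning
    inverse : ∀ k → (f *S invS f) k ≡ oneS k
    inverse zero = trans (cong (_* 1ℚ) f₀≡1) (*-identityˡ 1ℚ)
    inverse (suc k) = begin
      sumTo (suc k) (λ i → f i * invS f (suc k ∸ i))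
        ≡⟨ sumTo-suc k _ ⟩
      f 0 * invS f (suc k) + sumTo k (λ i → f (suc i) * invS f (k ∸ i))
        ≡⟨ cong₂ _+_ (trans (cong (_* invS f (suc k)) f₀≡1) (*-identityˡ (invS f (suc k))))
                     (sym (weightedSum-invVec f k 0)) ⟩
      invS f (suc k) + weightedSum f 0 (invVec f k)
        ≡⟨ cong (_+ weightedSum f 0 (invVec f k)) (invS-suc f k) ⟩
      - weightedSum f 0 (invVec f k) + weightedSum f 0 (invVec f k)
        ≡⟨ +-inverseˡ (weightedSum f 0 (invVec f k)) ⟩
      0ℚ ∎

  invS-^S-cancelˡ : ∀ f → f 0 ≡ 1ℚ → ∀ m g → ((invS f ^S m) *S ((f ^S m) *S g)) ≈S g
  invS-^S-cancelˡ f f₀≡1 m g = begin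
    (invS f ^S m) *S ((f ^S m) *S g)  ≈⟨ R.sym (*S-assoc (invS f ^S m) (f ^S m) g) ⟩
    ((invS f ^S m) *S (f ^S m)) *S g  ≈⟨ *S-congʳ g (R.sym (^S-distrib-*S (invS f) f m)) ⟩
    ((invS f *S f) ^S m) *S g         ≈⟨ *S-congʳ g (^S-cong m (R.trans (*S-comm (invS f) f) (invS-inverseʳ f f₀≡1))) ⟩
    (oneS ^S m) *S g                  ≈⟨ *S-congʳ g (oneS-^S m) ⟩
    oneS *S g                         ≈⟨ R.*-identityˡ g ⟩
    g                                 ∎
    where open ≈S-Reasoning

  ^S≈^ : ∀ f j → (f ^S j) ≈S (f ^ j)
  ^S≈^ f zero = R.refl
  ^S≈^ f (suc j) = *S-congˡ f (^S≈^ f j)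

  ×-coefficient : ∀ m f k → (m × f) k ≡ ℕ→ℚ m * f k
  ×-coefficient zero f k = sym (*-zeroˡ (f k))
  ×-coefficient (suc m) f k = begin
    f k + (m × f) k          ≡⟨ cong (f k +_) (×-coefficient m f k) ⟩
    f k + ℕ→ℚ m * f k        ≡⟨ cong (_+ ℕ→ℚ m * f k) (sym (*-identityˡ (f k))) ⟩
    1ℚ * f k + ℕ→ℚ m * f k   ≡⟨ sym (*-distribʳ-+ (f k) 1ℚ (ℕ→ℚ m)) ⟩
    (1ℚ + ℕ→ℚ m) * f k       ≡⟨ cong (_* f k) (sym (ℕ→ℚ-homo-+ 1 m)) ⟩
    ℕ→ℚ (suc m) * f k        ∎
    where open ≡-Reasoning

  ∑-coefficient : ∀ a (F : ℕ → Series) k → ∑ {suc a} (λ i → F (toℕ i)) k ≡ sumTo a (λ i → F i k)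
  ∑-coefficient zero F k = +-identityʳ (F 0 k)
  ∑-coefficient (suc a) F k =
    trans (cong (F 0 k +_) (∑-coefficient a (λ i → F (suc i)) k)) (sym (sumTo-suc a (λ i → F i k)))

module NegativeBinomialSeries where

  open RationalArithmetic
  open FiniteSums
  open PowerSeries
  open import Data.Nat as ℕ using (ℕ; zero; suc; _≤_; _∸_; z≤n; s≤s)
  import Data.Nat.Properties as ℕ
  open import Data.Rational using (ℚ; _+_; _*_; -_; 0ℚ; 1ℚ)
  open import Data.Rational.Properties
  open import Data.Rational.Solver using (module +-*-Solver)
  open import Relation.Binary.PropositionalEquality

  negBinomial : ℕ → ℕ → ℚ
  negBinomial n j = sign j * (fact (n ℕ.+ j) * (invFact n * invFact j))

  negBinomial-zero : ∀ n → negBinomial n 0 ≡ 1ℚ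
  negBinomial-zero n = begin
    1ℚ * (fact (n ℕ.+ 0) * (invFact n * 1ℚ))
      ≡⟨ cong (λ t → 1ℚ * (fact t * (invFact n * 1ℚ))) (ℕ.+-identityʳ n) ⟩
    1ℚ * (fact n * (invFact n * 1ℚ))
      ≡⟨ solve 2 (λ F I → con 1ℚ :* (F :* (I :* con 1ℚ)) := F :* I) refl (fact n) (invFact n) ⟩
    fact n * invFact n
      ≡⟨ invFact-inverseʳ n ⟩
    1ℚ ∎
    where open ≡-Reasoning
          open +-*-Solver

  negBinomial-suc : ∀ n j → ℕ→ℚ (suc j) * negBinomial n (suc j) ≡ - (ℕ→ℚ (suc n ℕ.+ j) * negBinomial n j)
  negBinomial-suc n j = begin
    j+1 * (- s * (fact (n ℕ.+ suc j) * (In * invFact (suc j))))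
      ≡⟨ cong₂ (λ x y → j+1 * (- s * (x * (In * y))))
           (trans (cong fact (ℕ.+-suc n j)) (fact-suc (n ℕ.+ j))) (invFact-suc j) ⟩
    j+1 * (- s * ((C * F) * (In * (1/[j+1] * Ij))))
      ≡⟨ solve 7 (λ j+1 1/[j+1] C F In Ij s → j+1 :* ((:- s) :* ((C :* F) :* (In :* (1/[j+1] :* Ij))))
                   := (:- (C :* (s :* (F :* (In :* Ij))))) :* (j+1 :* 1/[j+1])) refl j+1 1/[j+1] C F In Ij s ⟩
    - (C * negBinomial n j) * (j+1 * 1/[j+1])
      ≡⟨ cong (- (C * negBinomial n j) *_) (1/ℕ-inverseʳ (suc j)) ⟩
    - (C * negBinomial n j) * 1ℚ
      ≡⟨ *-identityʳ _ ⟩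
    - (C * negBinomial n j) ∎
    where
    open ≡-Reasoning
    open +-*-Solver
    j+1 = ℕ→ℚ (suc j)
    1/[j+1] = 1/ℕ (suc j)
    C = ℕ→ℚ (suc n ℕ.+ j)
    F = fact (n ℕ.+ j)
    In = invFact n
    Ij = invFact j
    s = sign j

  -- The coefficient form of (1 + u) d/du (1 + u)^{-(n+1)} = -(n+1) (1 + u)^{-(n+1)}.
  negBinomial-recurrence : ∀ n j →
    - ℕ→ℚ (suc n) * negBinomial n j ≡ ℕ→ℚ (suc j) * negBinomial n (suc j) + ℕ→ℚ j * negBinomial n j
  negBinomial-recurrence n j = begin
    - M * a
      ≡⟨ solve 3 (λ M j′ a → (:- M) :* a := (:- ((M :+ j′) :* a)) :+ j′ :* a) refl M j′ a ⟩
    - ((M + j′) * a) + j′ * a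
      ≡⟨ cong (λ t → - (t * a) + j′ * a) (sym (ℕ→ℚ-homo-+ (suc n) j)) ⟩
    - (ℕ→ℚ (suc n ℕ.+ j) * a) + j′ * a
      ≡⟨ cong (_+ j′ * a) (sym (negBinomial-suc n j)) ⟩
    ℕ→ℚ (suc j) * negBinomial n (suc j) + j′ * a ∎
    where
    open ≡-Reasoning
    open +-*-Solver
    M = ℕ→ℚ (suc n)
    j′ = ℕ→ℚ j
    a = negBinomial n j

  module ExpansionOfInversePower (E U : Series) (E≈1+U : E ≈S (oneS +S U)) (U₀≡0 : U 0 ≡ 0ℚ) (n : ℕ) where

    private
      a b : ℕ → ℚ
      a = negBinomial n
      b j = ℕ→ℚ (suc j) * a (suc j)

      M : ℚ
      M = ℕ→ℚ (suc n)

      W : Series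
      W = xDeriv E

      term partial : ℕ → Series
      term j = constS (a j) *S (U ^S j)
      partial N = sumS N term

      Z S₁ S₂ X : ℕ → Series
      Z j = (U ^S j) *S W
      S₁ N = sumS N (λ j → constS (b j) *S Z j)
      S₂ N = sumS N (λ j → constS (b j) *S Z (suc j))
      X N = constS (b (suc N)) *S Z (suc N)

    E₀≡1 : E 0 ≡ 1ℚ
    E₀≡1 = trans (at E≈1+U 0) (trans (cong (1ℚ +_) U₀≡0) (+-identityʳ 1ℚ))

    order-U : OrderAtLeast 1 U
    order-U zero _ = U₀≡0
    order-U (suc i) (s≤s ())

    xDeriv-U : xDeriv U ≈S W
    xDeriv-U = R.sym (begin
      xDeriv E                   ≈⟨ xDeriv-cong E≈1+U ⟩
      xDeriv (oneS +S U)         ≈⟨ xDeriv-+S oneS U ⟩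
      xDeriv oneS +S xDeriv U    ≈⟨ +S-congʳ (xDeriv U) xDeriv-oneS ⟩
      zeroS +S xDeriv U          ≈⟨ R.+-identityˡ (xDeriv U) ⟩
      xDeriv U                   ∎)
      where open ≈S-Reasoning

    xDeriv-term-zero : xDeriv (term 0) ≈S zeroS
    xDeriv-term-zero = R.trans (xDeriv-constS-*S (a 0) oneS)
      (R.trans (*S-congˡ (constS (a 0)) xDeriv-oneS) (R.zeroʳ (constS (a 0))))

    xDeriv-term-suc : ∀ j → xDeriv (term (suc j)) ≈S (constS (b j) *S Z j)
    xDeriv-term-suc j = begin
      xDeriv (constS (a (suc j)) *S (U ^S suc j))
        ≈⟨ xDeriv-constS-*S (a (suc j)) (U ^S suc j) ⟩
      constS (a (suc j)) *S xDeriv (U ^S suc j)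
        ≈⟨ *S-congˡ (constS (a (suc j))) (xDeriv-^S U j) ⟩
      constS (a (suc j)) *S (constS (ℕ→ℚ (suc j)) *S ((U ^S j) *S xDeriv U))
        ≈⟨ constS-*S-constS (a (suc j)) (ℕ→ℚ (suc j)) ((U ^S j) *S xDeriv U) ⟩
      constS (a (suc j) * ℕ→ℚ (suc j)) *S ((U ^S j) *S xDeriv U)
        ≈⟨ *S-cong (constS-cong (*-comm (a (suc j)) (ℕ→ℚ (suc j)))) (*S-congˡ (U ^S j) xDeriv-U) ⟩
      constS (b j) *S Z j ∎
      where open ≈S-Reasoning

    xDeriv-partial : ∀ N → xDeriv (partial (suc N)) ≈S S₁ N
    xDeriv-partial N = begin
      xDeriv (sumS (suc N) term)                            ≈⟨ xDeriv-sumS (suc N) term ⟩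
      sumS (suc N) (λ j → xDeriv (term j))                  ≈⟨ sumS-suc N (λ j → xDeriv (term j)) ⟩
      xDeriv (term 0) +S sumS N (λ j → xDeriv (term (suc j)))
        ≈⟨ R.+-cong xDeriv-term-zero (sumS-cong N xDeriv-term-suc) ⟩
      zeroS +S S₁ N                                         ≈⟨ R.+-identityˡ (S₁ N) ⟩
      S₁ N                                                  ∎
      where open ≈S-Reasoning

    E*S₁≈S₁+S₂ : ∀ N → (E *S S₁ N) ≈S (S₁ N +S S₂ N)
    E*S₁≈S₁+S₂ N = begin
      E *S S₁ N                        ≈⟨ *S-congʳ (S₁ N) E≈1+U ⟩
      (oneS +S U) *S S₁ N              ≈⟨ R.distribʳ (S₁ N) oneS U ⟩
      (oneS *S S₁ N) +S (U *S S₁ N)    ≈⟨ R.+-cong (R.*-identityˡ (S₁ N)) (*S-distribˡ-sumS U N (λ j → constS (b j) *S Z j)) ⟩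
      S₁ N +S sumS N (λ j → U *S (constS (b j) *S Z j))
        ≈⟨ +S-congˡ (S₁ N) (sumS-cong N (λ j →
             solve 4 (λ u c v w → u :* (c :* (v :* w)) := c :* ((u :* v) :* w)) R.refl U (constS (b j)) (U ^S j) W)) ⟩
      S₁ N +S S₂ N                     ∎
      where open ≈S-Reasoning
            open RingSolver

    -M*P*W≈S₁+X+S₂ : ∀ N → (constS (- M) *S (partial (suc N) *S W)) ≈S ((S₁ N +S X N) +S S₂ N)
    -M*P*W≈S₁+X+S₂ N = begin
      constS (- M) *S (sumS (suc N) term *S W)
        ≈⟨ *S-congˡ (constS (- M)) (*S-distribʳ-sumS W (suc N) term) ⟩
      constS (- M) *S sumS (suc N) (λ j → term j *S W)
        ≈⟨ *S-distribˡ-sumS (constS (- M)) (suc N) (λ j → term j *S W) ⟩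
      sumS (suc N) (λ j → constS (- M) *S (term j *S W))
        ≈⟨ sumS-cong (suc N) (λ j → R.trans (*S-congˡ (constS (- M)) (*S-assoc (constS (a j)) (U ^S j) W))
                                            (constS-*S-constS (- M) (a j) (Z j))) ⟩
      sumS (suc N) (λ j → constS (- M * a j) *S Z j)
        ≈⟨ sumS-cong (suc N) (λ j → R.trans
             (*S-congʳ (Z j) (R.trans (constS-cong (negBinomial-recurrence n j)) (constS-homo-+ (b j) (ℕ→ℚ j * a j))))
             (R.distribʳ (Z j) (constS (b j)) (constS (ℕ→ℚ j * a j)))) ⟩
      sumS (suc N) (λ j → (constS (b j) *S Z j) +S (constS (ℕ→ℚ j * a j) *S Z j))
        ≈⟨ sumS-+S (suc N) (λ j → constS (b j) *S Z j) (λ j → constS (ℕ→ℚ j * a j) *S Z j) ⟩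
      sumS (suc N) (λ j → constS (b j) *S Z j) +S sumS (suc N) (λ j → constS (ℕ→ℚ j * a j) *S Z j)
        ≈⟨ +S-congˡ (sumS (suc N) (λ j → constS (b j) *S Z j)) (sumS-suc N (λ j → constS (ℕ→ℚ j * a j) *S Z j)) ⟩
      (S₁ N +S X N) +S ((constS (0ℚ * a 0) *S Z 0) +S S₂ N)
        ≈⟨ +S-congˡ (S₁ N +S X N) (R.trans (+S-congʳ (S₂ N) (constS-zero (Z 0) (*-zeroˡ (a 0))))
                                           (R.+-identityˡ (S₂ N))) ⟩
      (S₁ N +S X N) +S S₂ N ∎
      where open ≈S-Reasoning

    partial-ode : ∀ N → ((E *S xDeriv (partial (suc N))) +S X N) ≈S (constS (- M) *S (partial (suc N) *S W))
    partial-ode N = begin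
      (E *S xDeriv (partial (suc N))) +S X N  ≈⟨ +S-congʳ (X N) (*S-congˡ E (xDeriv-partial N)) ⟩
      (E *S S₁ N) +S X N                      ≈⟨ +S-congʳ (X N) (E*S₁≈S₁+S₂ N) ⟩
      (S₁ N +S S₂ N) +S X N                   ≈⟨ solve 3 (λ a b c → (a :+ b) :+ c := (a :+ c) :+ b) R.refl (S₁ N) (S₂ N) (X N) ⟩
      (S₁ N +S X N) +S S₂ N                   ≈⟨ R.sym (-M*P*W≈S₁+X+S₂ N) ⟩
      constS (- M) *S (partial (suc N) *S W)  ∎
      where open ≈S-Reasoning
            open RingSolver

    xDeriv-E^-*S-partial : ∀ N → (xDeriv ((E ^S suc n) *S partial (suc N)) +S ((E ^S n) *S X N)) ≈S zeroS
    xDeriv-E^-*S-partial N = begin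
      xDeriv ((E ^S suc n) *S P) +S (Eⁿ *S X N)
        ≈⟨ +S-congʳ (Eⁿ *S X N) (xDeriv-*S (E ^S suc n) P) ⟩
      ((xDeriv (E ^S suc n) *S P) +S ((E *S Eⁿ) *S P′)) +S (Eⁿ *S X N)
        ≈⟨ +S-congʳ (Eⁿ *S X N) (+S-congʳ ((E *S Eⁿ) *S P′) (*S-congʳ P (xDeriv-^S E n))) ⟩
      (((constS M *S (Eⁿ *S W)) *S P) +S ((E *S Eⁿ) *S P′)) +S (Eⁿ *S X N)
        ≈⟨ solve 7 (λ m eⁿ w p e p′ x → ((m :* (eⁿ :* w)) :* p :+ (e :* eⁿ) :* p′) :+ eⁿ :* x
                      := m :* (eⁿ :* (w :* p)) :+ eⁿ :* (e :* p′ :+ x)) R.refl (constS M) Eⁿ W P E P′ (X N) ⟩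
      (constS M *S (Eⁿ *S (W *S P))) +S (Eⁿ *S ((E *S P′) +S X N))
        ≈⟨ +S-congˡ (constS M *S (Eⁿ *S (W *S P))) (*S-congˡ Eⁿ (partial-ode N)) ⟩
      (constS M *S (Eⁿ *S (W *S P))) +S (Eⁿ *S (constS (- M) *S (P *S W)))
        ≈⟨ solve 5 (λ m m′ eⁿ w p → m :* (eⁿ :* (w :* p)) :+ eⁿ :* (m′ :* (p :* w))
                      := (m :+ m′) :* (eⁿ :* (w :* p))) R.refl (constS M) (constS (- M)) Eⁿ W P ⟩
      (constS M +S constS (- M)) *S (Eⁿ *S (W *S P))
        ≈⟨ *S-congʳ (Eⁿ *S (W *S P)) (R.sym (constS-homo-+ M (- M))) ⟩
      constS (M + - M) *S (Eⁿ *S (W *S P))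
        ≈⟨ constS-zero (Eⁿ *S (W *S P)) (+-inverseʳ M) ⟩
      zeroS ∎
      where
      open ≈S-Reasoning
      open RingSolver
      Eⁿ = E ^S n
      P = partial (suc N)
      P′ = xDeriv (partial (suc N))

    order-E^-*S-X : ∀ N → OrderAtLeast (suc (suc N)) ((E ^S n) *S X N)
    order-E^-*S-X N = order-*S 0 (suc (suc N)) (E ^S n) (X N) (λ _ ())
      (order-*S 0 (suc (suc N)) (constS (b (suc N))) (Z (suc N)) (λ _ ())
        (subst (λ d → OrderAtLeast d (Z (suc N))) (ℕ.+-comm (suc N) 1)
          (order-*S (suc N) 1 (U ^S suc N) W (order-^S U order-U (suc N)) order-W)))
      where
      order-W : OrderAtLeast 1 W
      order-W zero _ = *-zeroˡ (E 0)
      order-W (suc i) (s≤s ())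

    partial-constant : ∀ N → partial N 0 ≡ 1ℚ
    partial-constant zero = trans (*-identityʳ (a 0)) (negBinomial-zero n)
    partial-constant (suc N) = begin
      partial N 0 + a (suc N) * (U ^S suc N) 0  ≡⟨ cong₂ (λ p u → p + a (suc N) * u) (partial-constant N)
                                                            (order-^S U order-U (suc N) 0 (s≤s z≤n)) ⟩
      1ℚ + a (suc N) * 0ℚ                      ≡⟨ cong (1ℚ +_) (*-zeroʳ (a (suc N))) ⟩
      1ℚ + 0ℚ                                  ≡⟨ +-identityʳ 1ℚ ⟩
      1ℚ                                       ∎
      where open ≡-Reasoning

    -- By xDeriv-E^-*S-partial, k·c_k = 0 for the coefficients c_k of E^{n+1}·P in degrees 0 < k ≤ N + 1.
    E^-*S-partial≡oneS : ∀ N k → k ≤ suc N → ((E ^S suc n) *S partial (suc N)) k ≡ oneS k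
    E^-*S-partial≡oneS N zero _ =
      trans (cong₂ _*_ (^S-constant E E₀≡1 (suc n)) (partial-constant (suc N))) (*-identityˡ 1ℚ)
    E^-*S-partial≡oneS N (suc k) k<N+2 = n*q≡0⇒q≡0 (suc k) (Q (suc k)) (begin
      ℕ→ℚ (suc k) * Q (suc k)                                ≡⟨ sym (+-identityʳ _) ⟩
      ℕ→ℚ (suc k) * Q (suc k) + 0ℚ                           ≡⟨ cong (ℕ→ℚ (suc k) * Q (suc k) +_)
                                                                   (sym (order-E^-*S-X N (suc k) (s≤s k<N+2))) ⟩
      ℕ→ℚ (suc k) * Q (suc k) + ((E ^S n) *S X N) (suc k)    ≡⟨ at (xDeriv-E^-*S-partial N) (suc k) ⟩
      0ℚ                                                     ∎)
      where
      open ≡-Reasoning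
      Q = (E ^S suc n) *S partial (suc N)

    invS-^S≡partial : ∀ N k → k ≤ suc N → (invS E ^S suc n) k ≡ partial (suc N) k
    invS-^S≡partial N k k≤N+1 = begin
      Iᵐ k                                         ≡⟨ sym (at (R.*-identityʳ Iᵐ) k) ⟩
      (Iᵐ *S oneS) k                               ≡⟨ sumTo-cong≤ k (λ i i≤k → cong (Iᵐ i *_)
                                                        (sym (E^-*S-partial≡oneS N (k ∸ i) (ℕ.≤-trans (ℕ.m∸n≤m k i) k≤N+1)))) ⟩
      (Iᵐ *S ((E ^S suc n) *S partial (suc N))) k  ≡⟨ at (invS-^S-cancelˡ E E₀≡1 (suc n) (partial (suc N))) k ⟩
      partial (suc N) k                            ∎
      where
      open ≡-Reasoning
      Iᵐ = invS E ^S suc n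
    invS-^S-coefficient : ∀ k → (invS E ^S suc n) k ≡ sumTo k (λ j → negBinomial n j * (U ^S j) k)
    invS-^S-coefficient k = begin
      (invS E ^S suc n) k                            ≡⟨ invS-^S≡partial k k (ℕ.n≤1+n k) ⟩
      sumTo k (λ j → term j k) + term (suc k) k      ≡⟨ cong (sumTo k (λ j → term j k) +_) top-term≡0 ⟩
      sumTo k (λ j → term j k) + 0ℚ                  ≡⟨ +-identityʳ _ ⟩
      sumTo k (λ j → term j k)                       ≡⟨ sumTo-cong k (λ j → at (constS-*S (a j) (U ^S j)) k) ⟩
      sumTo k (λ j → negBinomial n j * (U ^S j) k)   ∎
      where
      open ≡-Reasoning
      top-term≡0 : term (suc k) k ≡ 0ℚ
      top-term≡0 = trans (at (constS-*S (a (suc k)) (U ^S suc k)) k)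
        (trans (cong (a (suc k) *_) (order-^S U order-U (suc k) k (ℕ.n<1+n k))) (*-zeroʳ (a (suc k))))

module DerivativeOfInversePower where
  open RationalArithmetic
  open PowerSeries
  open import Data.Nat as ℕ using (ℕ; suc)
  import Data.Nat.Properties as ℕ
  open import Data.Rational using (ℚ; _+_; _*_; -_; 0ℚ; 1ℚ)
  open import Data.Rational.Properties
  open import Data.Rational.Solver using (module +-*-Solver)
  open import Relation.Binary.PropositionalEquality

  module _ (E : Series) (E₀≡1 : E 0 ≡ 1ℚ) (n : ℕ) where

    private
      I W Iᵐ : Series
      I = invS E
      W = xDeriv E
      Iᵐ = I ^S suc n

      M : ℚ
      M = ℕ→ℚ (suc n)

    xDeriv-invS : (xDeriv I +S ((I *S I) *S W)) ≈S zeroS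
    xDeriv-invS = begin
      xDeriv I +S ((I *S I) *S W)
        ≈⟨ +S-congʳ ((I *S I) *S W) (R.trans (R.sym (R.*-identityʳ (xDeriv I)))
                                             (*S-congˡ (xDeriv I) (R.sym (invS-inverseʳ E E₀≡1)))) ⟩
      (xDeriv I *S (E *S I)) +S ((I *S I) *S W)
        ≈⟨ solve 4 (λ i′ i e w → i′ :* (e :* i) :+ (i :* i) :* w := i :* (w :* i :+ e :* i′)) R.refl (xDeriv I) I E W ⟩
      I *S ((W *S I) +S (E *S xDeriv I))
        ≈⟨ *S-congˡ I (R.trans (R.sym (xDeriv-*S E I)) (R.trans (xDeriv-cong (invS-inverseʳ E E₀≡1)) xDeriv-oneS)) ⟩
      I *S zeroS
        ≈⟨ R.zeroʳ I ⟩
      zeroS ∎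
      where open ≈S-Reasoning
            open RingSolver

    xDeriv-invS-^S : (xDeriv Iᵐ +S (constS M *S ((I *S Iᵐ) *S W))) ≈S zeroS
    xDeriv-invS-^S = begin
      xDeriv Iᵐ +S (constS M *S ((I *S Iᵐ) *S W))
        ≈⟨ +S-congʳ (constS M *S ((I *S Iᵐ) *S W)) (xDeriv-^S I n) ⟩
      (constS M *S ((I ^S n) *S xDeriv I)) +S (constS M *S ((I *S (I *S (I ^S n))) *S W))
        ≈⟨ solve 5 (λ m iⁿ i′ i w → m :* (iⁿ :* i′) :+ m :* ((i :* (i :* iⁿ)) :* w)
                      := m :* (iⁿ :* (i′ :+ (i :* i) :* w))) R.refl (constS M) (I ^S n) (xDeriv I) I W ⟩
      constS M *S ((I ^S n) *S (xDeriv I +S ((I *S I) *S W)))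
        ≈⟨ *S-congˡ (constS M) (*S-congˡ (I ^S n) xDeriv-invS) ⟩
      constS M *S ((I ^S n) *S zeroS)
        ≈⟨ R.trans (*S-congˡ (constS M) (R.zeroʳ (I ^S n))) (R.zeroʳ (constS M)) ⟩
      zeroS ∎
      where open ≈S-Reasoning
            open RingSolver

    invS-^S-*S-[E+W] : ((I ^S (n ℕ.+ 2)) *S (E +S W)) ≈S (Iᵐ +S ((I *S Iᵐ) *S W))
    invS-^S-*S-[E+W] = begin
      (I ^S (n ℕ.+ 2)) *S (E +S W)
        ≈⟨ *S-congʳ (E +S W) (subst (λ t → (I ^S (n ℕ.+ 2)) ≈S (I ^S t)) (ℕ.+-comm n 2) R.refl) ⟩
      (I *S Iᵐ) *S (E +S W)
        ≈⟨ R.distribˡ (I *S Iᵐ) E W ⟩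
      ((I *S Iᵐ) *S E) +S ((I *S Iᵐ) *S W)
        ≈⟨ +S-congʳ ((I *S Iᵐ) *S W) (R.trans
             (solve 3 (λ i p e → (i :* p) :* e := p :* (e :* i)) R.refl I Iᵐ E)
             (R.trans (*S-congˡ Iᵐ (invS-inverseʳ E E₀≡1)) (R.*-identityʳ Iᵐ))) ⟩
      Iᵐ +S ((I *S Iᵐ) *S W) ∎
      where open ≈S-Reasoning
            open RingSolver

    -- k·p + M·y = 0 by xDeriv-invS-^S, where p and y are the k-th coefficients of the two summands.
    invS-^S-*S-[E+W]-coefficient : ∀ k →
      ((I ^S (n ℕ.+ 2)) *S (E +S W)) k ≡ ((M + - ℕ→ℚ k) * 1/ℕ (suc n)) * Iᵐ k
    invS-^S-*S-[E+W]-coefficient k = begin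
      ((I ^S (n ℕ.+ 2)) *S (E +S W)) k
        ≡⟨ at invS-^S-*S-[E+W] k ⟩
      p + y
        ≡⟨ cong₂ _+_ (sym (trans (cong (p *_) (1/ℕ-inverseʳ (suc n))) (*-identityʳ p)))
                     (sym (trans (cong (_* y) (1/ℕ-inverseˡ (suc n))) (*-identityˡ y))) ⟩
      p * (M * 1/M) + (1/M * M) * y
        ≡⟨ solve 5 (λ p y M 1/M K → p :* (M :* 1/M) :+ (1/M :* M) :* y
                     := ((M :+ (:- K)) :* 1/M) :* p :+ 1/M :* (K :* p :+ M :* y)) refl p y M 1/M K ⟩
      ((M + - K) * 1/M) * p + 1/M * (K * p + M * y)
        ≡⟨ cong (λ t → ((M + - K) * 1/M) * p + 1/M * t)
             (trans (cong (K * p +_) (sym (at (constS-*S M ((I *S Iᵐ) *S W)) k))) (at xDeriv-invS-^S k)) ⟩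
      ((M + - K) * 1/M) * p + 1/M * 0ℚ
        ≡⟨ trans (cong (((M + - K) * 1/M) * p +_) (*-zeroʳ 1/M)) (+-identityʳ _) ⟩
      ((M + - K) * 1/M) * p ∎
      where
      open ≡-Reasoning
      open +-*-Solver
      p = Iᵐ k
      y = ((I *S Iᵐ) *S W) k
      1/M = 1/ℕ (suc n)
      K = ℕ→ℚ k

module BellPolynomials where

  open RationalArithmetic
  open FiniteSums
  open PowerSeries
  open import Data.Nat as ℕ using (ℕ; zero; suc; _≤_; _<_; _∸_)
  import Data.Nat.Properties as ℕ
  open import Data.Nat.Combinatorics using (_C_)
  open import Data.Rational using (ℚ; _+_; _*_; 0ℚ; 1ℚ)
  open import Data.Rational.Properties
  open import Data.Rational.Solver using (module +-*-Solver)
  open import Data.List using (List; []; _∷_; _++_; map; filterᵇ; concatMap; upTo)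
  open import Data.Bool using (Bool; true; false; _∧_; T)
  import Data.Bool.Properties as Bool
  open import Data.Vec using (Vec; []; _∷_)
  open import Data.Empty using (⊥-elim)
  open import Relation.Nullary using (yes; no; ¬_)
  open import Relation.Binary using (tri<; tri≈; tri>)
  open import Relation.Binary.PropositionalEquality
  import Algebra.Properties.Semiring.Binomial

  egf : (ℕ → ℚ) → Series
  egf x zero    = 0ℚ
  egf x (suc m) = x (suc m) * invFact (suc m)

  monomial : (ℕ → ℚ) → ∀ {len} → ℕ → Vec ℕ len → ℚ
  monomial x s []       = 1ℚ
  monomial x s (i ∷ is) = invFact i * (egf x (suc s) ^ℚ i) * monomial x (suc s) is

  -- The product in bellTerm is a function local to Defs; the underscores below are
  -- solved by unification against it, after abstracting over its arguments.
  mutual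
    bellTerm≡fact*monomial : ∀ n x is → bellTerm n x is ≡ fact n * monomial x 0 is
    bellTerm≡fact*monomial zero x [] = refl
    bellTerm≡fact*monomial (suc n) x (i ∷ is) =
      cong (λ t → fact (suc n) * (invFact i * (egf x 1 ^ℚ i) * t)) (bellTerm-tail n x i is)

    private
      bellTerm-tail : ∀ n x i (is : Vec ℕ n) → _
      bellTerm-tail n x i is with suc n | i ∷ is | 1
      ... | m | v | s = bellTerm-local x v s is

      bellTerm-local : ∀ {m} x (v : Vec ℕ m) {len} s (is : Vec ℕ len) → _ ≡ monomial x s is
      bellTerm-local x v s [] = refl
      bellTerm-local x v s (i ∷ is) =
        cong (invFact i * (egf x (suc s) ^ℚ i) *_) (bellTerm-local x v (suc s) is)

  filterSum : ∀ {A : Set} → (A → Bool) → (A → ℚ) → List A → ℚ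
  filterSum p g xs = sumL (map g (filterᵇ p xs))

  filterSum-++ : ∀ {A : Set} (p : A → Bool) g xs ys → filterSum p g (xs ++ ys) ≡ filterSum p g xs + filterSum p g ys
  filterSum-++ p g [] ys = sym (+-identityˡ (filterSum p g ys))
  filterSum-++ p g (v ∷ xs) ys with p v
  ... | true  = trans (cong (g v +_) (filterSum-++ p g xs ys)) (sym (+-assoc (g v) (filterSum p g xs) (filterSum p g ys)))
  ... | false = filterSum-++ p g xs ys

  filterSum-concatMap : ∀ {A B : Set} (p : A → Bool) g (f : B → List A) ys →
                        filterSum p g (concatMap f ys) ≡ sumL (map (λ y → filterSum p g (f y)) ys)
  filterSum-concatMap p g f [] = refl
  filterSum-concatMap p g f (y ∷ ys) =
    trans (filterSum-++ p g (f y) (concatMap f ys)) (cong (filterSum p g (f y) +_) (filterSum-concatMap p g f ys))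

  filterSum-map : ∀ {A B : Set} (p : A → Bool) g (h : B → A) xs →
                  filterSum p g (map h xs) ≡ filterSum (λ v → p (h v)) (λ v → g (h v)) xs
  filterSum-map p g h [] = refl
  filterSum-map p g h (v ∷ xs) with p (h v)
  ... | true  = cong (g (h v) +_) (filterSum-map p g h xs)
  ... | false = filterSum-map p g h xs

  filterSum-cong : ∀ {A : Set} {p q : A → Bool} {g h : A → ℚ} xs →
                   (∀ v → p v ≡ q v) → (∀ v → g v ≡ h v) → filterSum p g xs ≡ filterSum q h xs
  filterSum-cong [] p≗q g≗h = refl
  filterSum-cong {p = p} {q} (v ∷ xs) p≗q g≗h with p v | q v | p≗q v
  ... | true  | true  | refl = cong₂ _+_ (g≗h v) (filterSum-cong xs p≗q g≗h)
  ... | false | false | refl = filterSum-cong xs p≗q g≗h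

  filterSum-none : ∀ {A : Set} (p : A → Bool) g xs → (∀ v → p v ≡ false) → filterSum p g xs ≡ 0ℚ
  filterSum-none p g [] p≡false = refl
  filterSum-none p g (v ∷ xs) p≡false with p v | p≡false v
  ... | false | refl = filterSum-none p g xs p≡false

  *-distribˡ-filterSum : ∀ {A : Set} (p : A → Bool) (g : A → ℚ) c xs →
                         filterSum p (λ v → c * g v) xs ≡ c * filterSum p g xs
  *-distribˡ-filterSum p g c [] = sym (*-zeroʳ c)
  *-distribˡ-filterSum p g c (v ∷ xs) with p v
  ... | true  = trans (cong (c * g v +_) (*-distribˡ-filterSum p g c xs)) (sym (*-distribˡ-+ c (g v) (filterSum p g xs)))
  ... | false = *-distribˡ-filterSum p g c xs

  private
    T-injective : ∀ {b c : Bool} → (T b → T c) → (T c → T b) → b ≡ c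
    T-injective {false} {false} _ _ = refl
    T-injective {false} {true}  _ g = ⊥-elim (g _)
    T-injective {true}  {false} f _ = ⊥-elim (f _)
    T-injective {true}  {true}  _ _ = refl

  ≡ᵇ-+ˡ : ∀ i c a → i ≤ a → ((i ℕ.+ c) ℕ.≡ᵇ a) ≡ (c ℕ.≡ᵇ (a ∸ i))
  ≡ᵇ-+ˡ i c a i≤a = T-injective
    (λ t → ℕ.≡⇒≡ᵇ c (a ∸ i) (trans (sym (ℕ.m+n∸m≡n i c)) (cong (_∸ i) (ℕ.≡ᵇ⇒≡ (i ℕ.+ c) a t))))
    (λ t → ℕ.≡⇒≡ᵇ (i ℕ.+ c) a (trans (cong (i ℕ.+_) (ℕ.≡ᵇ⇒≡ c (a ∸ i) t)) (ℕ.m+[n∸m]≡n i≤a)))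

  ≡ᵇ-+ˡ-false : ∀ i c a → ¬ (i ≤ a) → ((i ℕ.+ c) ℕ.≡ᵇ a) ≡ false
  ≡ᵇ-+ˡ-false i c a i≰a =
    T-injective (λ t → i≰a (ℕ.≤-trans (ℕ.m≤m+n i c) (ℕ.≤-reflexive (ℕ.≡ᵇ⇒≡ (i ℕ.+ c) a t)))) (λ ())

  module _ (x : ℕ → ℚ) where

    Uabove : ℕ → Series
    Uabove s i = guard (s ℕ.<? i) (egf x i)

    Uat : ℕ → Series
    Uat s i = guard (i ℕ.≟ suc s) (egf x (suc s))

    egf≈Uabove-zero : egf x ≈S Uabove 0
    egf≈Uabove-zero = mk≈ λ { zero → refl ; (suc i) → refl }

    Uabove-split : ∀ s → Uabove s ≈S (Uat s +S Uabove (suc s))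
    Uabove-split s = mk≈ split
      where
      split : ∀ i → Uabove s i ≡ Uat s i + Uabove (suc s) i
      split i with ℕ.<-cmp i (suc s)
      ... | tri< i<1+s i≢1+s i≯1+s = begin
        Uabove s i                             ≡⟨ guard-no (s ℕ.<? i) (egf x i) (λ s<i → ℕ.<-irrefl refl (ℕ.<-≤-trans i<1+s s<i)) ⟩
        0ℚ                                     ≡⟨ sym (+-identityʳ 0ℚ) ⟩
        0ℚ + 0ℚ                                ≡⟨ sym (cong₂ _+_ (guard-no (i ℕ.≟ suc s) (egf x (suc s)) i≢1+s)
                                                                 (guard-no (suc s ℕ.<? i) (egf x i) i≯1+s)) ⟩
        Uat s i + Uabove (suc s) i             ∎
        where open ≡-Reasoning
      ... | tri≈ _ refl 1+s≮1+s = begin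
        Uabove s (suc s)                       ≡⟨ guard-yes (s ℕ.<? suc s) (egf x (suc s)) ℕ.≤-refl ⟩
        egf x (suc s)                          ≡⟨ sym (+-identityʳ (egf x (suc s))) ⟩
        egf x (suc s) + 0ℚ                     ≡⟨ sym (cong₂ _+_ (guard-yes (suc s ℕ.≟ suc s) (egf x (suc s)) refl)
                                                                 (guard-no (suc s ℕ.<? suc s) (egf x (suc s)) 1+s≮1+s)) ⟩
        Uat s (suc s) + Uabove (suc s) (suc s) ∎
        where open ≡-Reasoning
      ... | tri> i≮1+s i≢1+s 1+s<i = begin
        Uabove s i                             ≡⟨ guard-yes (s ℕ.<? i) (egf x i) (ℕ.<-trans ℕ.≤-refl 1+s<i) ⟩
        egf x i                                ≡⟨ sym (+-identityˡ (egf x i)) ⟩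
        0ℚ + egf x i                           ≡⟨ sym (cong₂ _+_ (guard-no (i ℕ.≟ suc s) (egf x (suc s)) i≢1+s)
                                                                 (guard-yes (suc s ℕ.<? i) (egf x i) 1+s<i)) ⟩
        Uat s i + Uabove (suc s) i             ∎
        where open ≡-Reasoning

    Uat-*S : ∀ s G w → (Uat s *S G) w ≡ guard (suc s ℕ.≤? w) (egf x (suc s) * G (w ∸ suc s))
    Uat-*S s G w = trans (sumTo-single w (suc s) (λ j → Uat s j * G (w ∸ j)) off-diagonal)
      (guard-cong (suc s ℕ.≤? w) (cong (_* G (w ∸ suc s)) (guard-yes (suc s ℕ.≟ suc s) (egf x (suc s)) refl)))
      where
      off-diagonal : ∀ j → j ≢ suc s → Uat s j * G (w ∸ j) ≡ 0ℚ
      off-diagonal j j≢1+s =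
        trans (cong (_* G (w ∸ j)) (guard-no (j ℕ.≟ suc s) (egf x (suc s)) j≢1+s)) (*-zeroˡ (G (w ∸ j)))

    Uat-^S-*S : ∀ s i G w →
      ((Uat s ^S i) *S G) w ≡ guard (suc s ℕ.* i ℕ.≤? w) ((egf x (suc s) ^ℚ i) * G (w ∸ suc s ℕ.* i))
    Uat-^S-*S s zero G w rewrite ℕ.*-zeroʳ s = trans (at (R.*-identityˡ G) w) (sym (*-identityˡ (G w)))
    Uat-^S-*S s (suc i) G w = begin
      ((Uat s *S (Uat s ^S i)) *S G) w
        ≡⟨ at (*S-assoc (Uat s) (Uat s ^S i) G) w ⟩
      (Uat s *S ((Uat s ^S i) *S G)) w
        ≡⟨ Uat-*S s ((Uat s ^S i) *S G) w ⟩
      guard (d ℕ.≤? w) (u * ((Uat s ^S i) *S G) (w ∸ d))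
        ≡⟨ guard-cong (d ℕ.≤? w) (cong (u *_) (Uat-^S-*S s i G (w ∸ d))) ⟩
      guard (d ℕ.≤? w) (u * guard (d ℕ.* i ℕ.≤? w ∸ d) ((u ^ℚ i) * G (w ∸ d ∸ d ℕ.* i)))
        ≡⟨ merge-guards ⟩
      guard (d ℕ.* suc i ℕ.≤? w) ((u ^ℚ suc i) * G (w ∸ d ℕ.* suc i)) ∎
      where
      open ≡-Reasoning
      d = suc s
      u = egf x (suc s)
      d*[1+i] : d ℕ.* suc i ≡ d ℕ.+ d ℕ.* i
      d*[1+i] = ℕ.*-suc d i
      merge-guards : guard (d ℕ.≤? w) (u * guard (d ℕ.* i ℕ.≤? w ∸ d) ((u ^ℚ i) * G (w ∸ d ∸ d ℕ.* i)))
                     ≡ guard (d ℕ.* suc i ℕ.≤? w) ((u ^ℚ suc i) * G (w ∸ d ℕ.* suc i))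
      merge-guards with d ℕ.≤? w
      ... | no d≰w = sym (guard-no (d ℕ.* suc i ℕ.≤? w) _ (λ le → d≰w
              (ℕ.≤-trans (ℕ.≤-trans (ℕ.m≤m+n d (d ℕ.* i)) (ℕ.≤-reflexive (sym d*[1+i]))) le)))
      ... | yes d≤w with d ℕ.* i ℕ.≤? w ∸ d
      ...   | yes di≤w∸d = sym (trans (guard-yes (d ℕ.* suc i ℕ.≤? w) _ d[1+i]≤w)
                (trans (cong (λ t → (u ^ℚ suc i) * G t) (trans (cong (w ∸_) d*[1+i]) (sym (ℕ.∸-+-assoc w d (d ℕ.* i)))))
                       (*-assoc u (u ^ℚ i) _)))
        where
        d[1+i]≤w : d ℕ.* suc i ≤ w
        d[1+i]≤w = ℕ.≤-trans (ℕ.≤-reflexive d*[1+i])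
                     (ℕ.≤-trans (ℕ.+-monoʳ-≤ d di≤w∸d) (ℕ.≤-reflexive (ℕ.m+[n∸m]≡n d≤w)))
      ...   | no di≰w∸d = trans (*-zeroʳ u) (sym (guard-no (d ℕ.* suc i ℕ.≤? w) _ (λ le → di≰w∸d
                (ℕ.≤-trans (ℕ.≤-reflexive (sym (ℕ.m+n∸m≡n d (d ℕ.* i))))
                           (ℕ.∸-monoˡ-≤ d (ℕ.≤-trans (ℕ.≤-reflexive (sym d*[1+i])) le))))))

    private
      module Binomial (s : ℕ) =
        Algebra.Properties.Semiring.Binomial R.semiring (Uat s) (Uabove (suc s))

    binomialTerm : ℕ → ℕ → ℕ → ℕ → ℚ
    binomialTerm s a w i = guard (i ℕ.≤? a) (guard (suc s ℕ.* i ℕ.≤? w)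
      (invFact i * (egf x (suc s) ^ℚ i) * (invFact (a ∸ i) * (Uabove (suc s) ^S (a ∸ i)) (w ∸ suc s ℕ.* i))))

    binomialExpansion-term : ∀ s a w i → i ≤ a →
      invFact a * ((a C i) × ((Uat s ^ i) *S (Uabove (suc s) ^ (a ∸ i)))) w ≡ binomialTerm s a w i
    binomialExpansion-term s a w i i≤a = begin
      invFact a * ((a C i) × ((Uat s ^ i) *S (V ^ (a ∸ i)))) w
        ≡⟨ cong (invFact a *_) (trans (×-coefficient (a C i) ((Uat s ^ i) *S (V ^ (a ∸ i))) w)
             (cong (ℕ→ℚ (a C i) *_) (at (R.sym (*S-cong (^S≈^ (Uat s) i) (^S≈^ V (a ∸ i)))) w))) ⟩
      invFact a * (ℕ→ℚ (a C i) * ((Uat s ^S i) *S (V ^S (a ∸ i))) w)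
        ≡⟨ cong (λ t → invFact a * (ℕ→ℚ (a C i) * t)) (Uat-^S-*S s i (V ^S (a ∸ i)) w) ⟩
      invFact a * (ℕ→ℚ (a C i) * guard (d ℕ.* i ℕ.≤? w) ((u ^ℚ i) * Vᵃ⁻ⁱ))
        ≡⟨ trans (cong (invFact a *_) (*-distribˡ-guard (d ℕ.* i ℕ.≤? w) (ℕ→ℚ (a C i)) ((u ^ℚ i) * Vᵃ⁻ⁱ)))
                 (*-distribˡ-guard (d ℕ.* i ℕ.≤? w) (invFact a) (ℕ→ℚ (a C i) * ((u ^ℚ i) * Vᵃ⁻ⁱ))) ⟩
      guard (d ℕ.* i ℕ.≤? w) (invFact a * (ℕ→ℚ (a C i) * ((u ^ℚ i) * Vᵃ⁻ⁱ)))
        ≡⟨ guard-cong (d ℕ.* i ℕ.≤? w) (begin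
             invFact a * (ℕ→ℚ (a C i) * ((u ^ℚ i) * Vᵃ⁻ⁱ))
               ≡⟨ sym (*-assoc (invFact a) (ℕ→ℚ (a C i)) ((u ^ℚ i) * Vᵃ⁻ⁱ)) ⟩
             (invFact a * ℕ→ℚ (a C i)) * ((u ^ℚ i) * Vᵃ⁻ⁱ)
               ≡⟨ cong (_* ((u ^ℚ i) * Vᵃ⁻ⁱ)) (invFact*C≡invFact*invFact a i i≤a) ⟩
             (invFact i * invFact (a ∸ i)) * ((u ^ℚ i) * Vᵃ⁻ⁱ)
               ≡⟨ solve 4 (λ A B P X → (A :* B) :* (P :* X) := A :* P :* (B :* X)) refl
                    (invFact i) (invFact (a ∸ i)) (u ^ℚ i) Vᵃ⁻ⁱ ⟩
             invFact i * (u ^ℚ i) * (invFact (a ∸ i) * Vᵃ⁻ⁱ) ∎) ⟩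
      guard (d ℕ.* i ℕ.≤? w) (invFact i * (u ^ℚ i) * (invFact (a ∸ i) * Vᵃ⁻ⁱ))
        ≡⟨ sym (guard-yes (i ℕ.≤? a) _ i≤a) ⟩
      binomialTerm s a w i ∎
      where
      open ≡-Reasoning
      open +-*-Solver
      V = Uabove (suc s)
      d = suc s
      u = egf x (suc s)
      Vᵃ⁻ⁱ = (V ^S (a ∸ i)) (w ∸ d ℕ.* i)

    Uabove-^S-coefficient : ∀ s a w → invFact a * (Uabove s ^S a) w ≡ sumTo a (binomialTerm s a w)
    Uabove-^S-coefficient s a w = begin
      invFact a * (Uabove s ^S a) w
        ≡⟨ cong (invFact a *_) (at (R.trans (^S-cong a (Uabove-split s))
             (R.trans (^S≈^ (Uat s +S V) a) (Binomial.theorem s (*S-comm (Uat s) V) a))) w) ⟩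
      invFact a * Binomial.binomialExpansion s a w
        ≡⟨ cong (invFact a *_) (∑-coefficient a (λ i → (a C i) × ((Uat s ^ i) *S (V ^ (a ∸ i)))) w) ⟩
      invFact a * sumTo a (λ i → ((a C i) × ((Uat s ^ i) *S (V ^ (a ∸ i)))) w)
        ≡⟨ *-distribˡ-sumTo a (invFact a) (λ i → ((a C i) × ((Uat s ^ i) *S (V ^ (a ∸ i)))) w) ⟩
      sumTo a (λ i → invFact a * ((a C i) × ((Uat s ^ i) *S (V ^ (a ∸ i)))) w)
        ≡⟨ sumTo-cong≤ a (binomialExpansion-term s a w) ⟩
      sumTo a (binomialTerm s a w) ∎
      where
      open ≡-Reasoning
      V = Uabove (suc s)

    -- The Bell sum over exponents (i_{s+1}, …, i_{s+L}) bounded by b with Σ i_m = a and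
    -- Σ m·i_m = w; by the multinomial theorem it is [x^w] (Uabove s)^a / a! once b and s + L reach w.
    constraint : ℕ → ℕ → ℕ → ∀ {len} → Vec ℕ len → Bool
    constraint s a w v = (countSum v ℕ.≡ᵇ a) ∧ (weightSum s v ℕ.≡ᵇ w)

    partialBell : ℕ → ℕ → ℕ → ℕ → ℕ → ℚ
    partialBell s L b a w = filterSum (constraint s a w) (monomial x s) (allVecs L b)

    partialBell-[] : ∀ s b a w → w ≤ s → partialBell s 0 b a w ≡ invFact a * (Uabove s ^S a) w
    partialBell-[] s b zero zero    _ = refl
    partialBell-[] s b zero (suc w) _ = refl
    partialBell-[] s b (suc a) w w≤s = sym (trans (cong (invFact (suc a) *_) (sumTo-zero w _ below-s))
                                                  (*-zeroʳ (invFact (suc a))))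
      where
      below-s : ∀ j → j ≤ w → Uabove s j * (Uabove s ^S a) (w ∸ j) ≡ 0ℚ
      below-s j j≤w = trans (cong (_* (Uabove s ^S a) (w ∸ j))
                              (guard-no (s ℕ.<? j) (egf x j) (λ s<j → ℕ.<-irrefl refl (ℕ.<-≤-trans s<j (ℕ.≤-trans j≤w w≤s)))))
                            (*-zeroˡ ((Uabove s ^S a) (w ∸ j)))

    partialBell-∷ : ∀ L s b a w →
      (∀ a′ w′ → w′ ≤ suc s ℕ.+ L → w′ ≤ b → partialBell (suc s) L b a′ w′ ≡ invFact a′ * (Uabove (suc s) ^S a′) w′) →
      w ≤ s ℕ.+ suc L → w ≤ b → ∀ i →
      filterSum (λ v → constraint s a w (i ∷ v)) (λ v → monomial x s (i ∷ v)) (allVecs L b) ≡ binomialTerm s a w i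
    partialBell-∷ L s b a w IH w≤s+L+1 w≤b i with i ℕ.≤? a | suc s ℕ.* i ℕ.≤? w
    ... | no i≰a | _ = filterSum-none _ _ (allVecs L b) (λ v →
            cong (_∧ ((suc s ℕ.* i ℕ.+ weightSum (suc s) v) ℕ.≡ᵇ w)) (≡ᵇ-+ˡ-false i (countSum v) a i≰a))
    ... | yes i≤a | no di≰w = filterSum-none _ _ (allVecs L b) (λ v →
            trans (cong ((i ℕ.+ countSum v ℕ.≡ᵇ a) ∧_) (≡ᵇ-+ˡ-false (suc s ℕ.* i) (weightSum (suc s) v) w di≰w))
                  (Bool.∧-zeroʳ _))
    ... | yes i≤a | yes di≤w = begin
      filterSum (λ v → constraint s a w (i ∷ v)) (λ v → monomial x s (i ∷ v)) (allVecs L b)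
        ≡⟨ filterSum-cong (allVecs L b)
             (λ v → cong₂ _∧_ (≡ᵇ-+ˡ i (countSum v) a i≤a) (≡ᵇ-+ˡ (suc s ℕ.* i) (weightSum (suc s) v) w di≤w))
             (λ v → refl) ⟩
      filterSum (constraint (suc s) (a ∸ i) w′) (λ v → c * monomial x (suc s) v) (allVecs L b)
        ≡⟨ *-distribˡ-filterSum (constraint (suc s) (a ∸ i) w′) (monomial x (suc s)) c (allVecs L b) ⟩
      c * partialBell (suc s) L b (a ∸ i) w′
        ≡⟨ cong (c *_) (IH (a ∸ i) w′ w′≤s+1+L (ℕ.≤-trans (ℕ.m∸n≤m w (suc s ℕ.* i)) w≤b)) ⟩
      c * (invFact (a ∸ i) * (Uabove (suc s) ^S (a ∸ i)) w′) ∎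
      where
      open ≡-Reasoning
      c = invFact i * (egf x (suc s) ^ℚ i)
      w′ = w ∸ suc s ℕ.* i
      w′≤s+1+L : w′ ≤ suc s ℕ.+ L
      w′≤s+1+L = ℕ.≤-trans (ℕ.m∸n≤m w (suc s ℕ.* i)) (ℕ.≤-trans w≤s+L+1 (ℕ.≤-reflexive (ℕ.+-suc s L)))

    partialBell≡ : ∀ L s b a w → w ≤ s ℕ.+ L → w ≤ b → partialBell s L b a w ≡ invFact a * (Uabove s ^S a) w
    partialBell≡ zero s b a w w≤s+0 _ = partialBell-[] s b a w (ℕ.≤-trans w≤s+0 (ℕ.≤-reflexive (ℕ.+-identityʳ s)))
    partialBell≡ (suc L) s b a w w≤s+L+1 w≤b = begin
      partialBell s (suc L) b a w
        ≡⟨ filterSum-concatMap (constraint s a w) (monomial x s) (λ i → map (i ∷_) (allVecs L b)) (upTo (suc b)) ⟩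
      sumL (map (λ i → filterSum (constraint s a w) (monomial x s) (map (i ∷_) (allVecs L b))) (upTo (suc b)))
        ≡⟨ sumL-applyUpTo (λ i → filterSum (constraint s a w) (monomial x s) (map (i ∷_) (allVecs L b))) b (λ i → i) ⟩
      sumTo b (λ i → filterSum (constraint s a w) (monomial x s) (map (i ∷_) (allVecs L b)))
        ≡⟨ sumTo-cong b (λ i → trans (filterSum-map (constraint s a w) (monomial x s) (i ∷_) (allVecs L b))
             (partialBell-∷ L s b a w (λ a′ w′ → partialBell≡ L (suc s) b a′ w′) w≤s+L+1 w≤b i)) ⟩
      sumTo b (binomialTerm s a w)
        ≡⟨ sym (sumTo-extend b a (binomialTerm s a w) above-b) ⟩
      sumTo (b ℕ.+ a) (binomialTerm s a w)
        ≡⟨ cong (λ t → sumTo t (binomialTerm s a w)) (ℕ.+-comm b a) ⟩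
      sumTo (a ℕ.+ b) (binomialTerm s a w)
        ≡⟨ sumTo-extend a b (binomialTerm s a w) above-a ⟩
      sumTo a (binomialTerm s a w)
        ≡⟨ sym (Uabove-^S-coefficient s a w) ⟩
      invFact a * (Uabove s ^S a) w ∎
      where
      open ≡-Reasoning
      above-b : ∀ i → b < i → binomialTerm s a w i ≡ 0ℚ
      above-b i b<i = trans (guard-cong (i ℕ.≤? a) (guard-no (suc s ℕ.* i ℕ.≤? w) _ (λ di≤w → ℕ.<-irrefl refl
        (ℕ.<-≤-trans (ℕ.<-≤-trans b<i (ℕ.m≤m+n i (s ℕ.* i))) (ℕ.≤-trans di≤w w≤b))))) (guard-zero (i ℕ.≤? a))
      above-a : ∀ i → a < i → binomialTerm s a w i ≡ 0ℚ
      above-a i a<i = guard-no (i ℕ.≤? a) _ (λ i≤a → ℕ.<-irrefl refl (ℕ.<-≤-trans a<i i≤a))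

    bell≡egf-^S-coefficient : ∀ k j → bell k j x ≡ fact k * (invFact j * (egf x ^S j) k)
    bell≡egf-^S-coefficient k j = begin
      bell k j x
        ≡⟨ sumL-map-cong (filterᵇ (constraint 0 j k) (allVecs k k)) (bellTerm≡fact*monomial k x) ⟩
      filterSum (constraint 0 j k) (λ v → fact k * monomial x 0 v) (allVecs k k)
        ≡⟨ *-distribˡ-filterSum (constraint 0 j k) (monomial x 0) (fact k) (allVecs k k) ⟩
      fact k * partialBell 0 k k j k
        ≡⟨ cong (fact k *_) (partialBell≡ k 0 k j k ℕ.≤-refl ℕ.≤-refl) ⟩
      fact k * (invFact j * (Uabove 0 ^S j) k)
        ≡⟨ cong (λ t → fact k * (invFact j * t)) (at (^S-cong j (R.sym egf≈Uabove-zero)) k) ⟩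
      fact k * (invFact j * (egf x ^S j) k) ∎
      where open ≡-Reasoning

module CoefficientsOfTser where

  open RationalArithmetic
  open FiniteSums
  open PowerSeries
  open NegativeBinomialSeries using (negBinomial)
  open BellPolynomials using (egf; bell≡egf-^S-coefficient)
  open import Data.Nat as ℕ using (ℕ; zero; suc; _!)
  import Data.Nat.Properties as ℕ
  open import Data.Integer as ℤ using (ℤ)
  open import Data.Rational using (ℚ; _/_; _+_; _*_; -_; 0ℚ; 1ℚ)
  open import Data.Rational.Properties
  open import Data.Rational.Solver using (module +-*-Solver)
  open import Relation.Binary.PropositionalEquality
  open ≡-Reasoning

  module _ (e : ℕ → ℤ) where

    scaledCoefficients : ℕ → ℚ
    scaledCoefficients m = fact m * ℤ→ℚ (e m)

    U : Series
    U = egf scaledCoefficients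

    Eser≈1+U : Eser e ≈S (oneS +S U)
    Eser≈1+U = mk≈ λ { zero → refl ; (suc m) → sym (begin
      0ℚ + fact (suc m) * ℤ→ℚ (e (suc m)) * invFact (suc m)   ≡⟨ +-identityˡ _ ⟩
      fact (suc m) * ℤ→ℚ (e (suc m)) * invFact (suc m)        ≡⟨ solve 3 (λ F z I → F :* z :* I := (F :* I) :* z) refl
                                                                    (fact (suc m)) (ℤ→ℚ (e (suc m))) (invFact (suc m)) ⟩
      fact (suc m) * invFact (suc m) * ℤ→ℚ (e (suc m))        ≡⟨ cong (_* ℤ→ℚ (e (suc m))) (invFact-inverseʳ (suc m)) ⟩
      1ℚ * ℤ→ℚ (e (suc m))                                    ≡⟨ *-identityˡ _ ⟩
      ℤ→ℚ (e (suc m))                                         ∎) }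
      where open +-*-Solver

    module _ (n : ℕ) where

      private
        M 1/M : ℚ
        M = ℕ→ℚ (suc n)
        1/M = 1/ℕ (suc n)

        innerTerm : ℕ → ℕ → ℚ
        innerTerm k j = sign j * ((ℤ.+ ((n ℕ.+ j) !)) / ((n ℕ.+ 1) !)) {{ℕ._!≢0 (n ℕ.+ 1)}}
                        * bell k j scaledCoefficients

      innerTerm≡ : ∀ k j → innerTerm k j ≡ (fact k * 1/M) * (negBinomial n j * (U ^S j) k)
      innerTerm≡ k j = begin
        innerTerm k j
          ≡⟨ cong₂ (λ q b → sign j * q * b)
               (trans (/-as-* (ℤ.+ ((n ℕ.+ j) !)) ((n ℕ.+ 1) !) {{ℕ._!≢0 (n ℕ.+ 1)}})
                      (cong (fact (n ℕ.+ j) *_) (trans (cong invFact (ℕ.+-comm n 1)) (invFact-suc n))))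
               (bell≡egf-^S-coefficient scaledCoefficients k j) ⟩
        sign j * (fact (n ℕ.+ j) * (1/M * invFact n)) * (fact k * (invFact j * V))
          ≡⟨ solve 7 (λ s F 1/M In K Ij V → s :* (F :* (1/M :* In)) :* (K :* (Ij :* V))
                       := (K :* 1/M) :* ((s :* (F :* (In :* Ij))) :* V))
               refl (sign j) (fact (n ℕ.+ j)) 1/M (invFact n) (fact k) (invFact j) V ⟩
        (fact k * 1/M) * (negBinomial n j * V) ∎
        where
        open +-*-Solver
        V = (U ^S j) k

      innerSum≡ : ∀ k′ → sumTo k′ (λ i → innerTerm (suc k′) (suc i))
                         ≡ (fact (suc k′) * 1/M) * sumTo (suc k′) (λ j → negBinomial n j * (U ^S j) (suc k′))
      innerSum≡ k′ = begin
        sumTo k′ (λ i → innerTerm k (suc i))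
          ≡⟨ sumTo-cong k′ (λ i → innerTerm≡ k (suc i)) ⟩
        sumTo k′ (λ i → (fact k * 1/M) * (negBinomial n (suc i) * (U ^S suc i) k))
          ≡⟨ sym (*-distribˡ-sumTo k′ (fact k * 1/M) _) ⟩
        (fact k * 1/M) * sumTo k′ (λ i → negBinomial n (suc i) * (U ^S suc i) k)
          ≡⟨ cong ((fact k * 1/M) *_) (sym (begin
               sumTo k (λ j → negBinomial n j * (U ^S j) k)
                 ≡⟨ sumTo-suc k′ (λ j → negBinomial n j * (U ^S j) k) ⟩
               negBinomial n 0 * 0ℚ + sumTo k′ (λ i → negBinomial n (suc i) * (U ^S suc i) k)
                 ≡⟨ cong (_+ sumTo k′ (λ i → negBinomial n (suc i) * (U ^S suc i) k)) (*-zeroʳ (negBinomial n 0)) ⟩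
               0ℚ + sumTo k′ (λ i → negBinomial n (suc i) * (U ^S suc i) k)
                 ≡⟨ +-identityˡ _ ⟩
               sumTo k′ (λ i → negBinomial n (suc i) * (U ^S suc i) k) ∎)) ⟩
        (fact k * 1/M) * sumTo k (λ j → negBinomial n j * (U ^S j) k) ∎
        where k = suc k′

      Tser-coefficient : ∀ k → Tser n e k ≡ ((M + - ℕ→ℚ k) * 1/M) * sumTo k (λ j → negBinomial n j * (U ^S j) k)
      Tser-coefficient zero = sym (begin
        ((M + 0ℚ) * 1/M) * (negBinomial n 0 * 1ℚ)  ≡⟨ cong₂ (λ p q → (p * 1/M) * q) (+-identityʳ M) (*-identityʳ _) ⟩
        (M * 1/M) * negBinomial n 0               ≡⟨ cong₂ _*_ (1/ℕ-inverseʳ (suc n)) (NegativeBinomialSeries.negBinomial-zero n) ⟩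
        1ℚ * 1ℚ                                   ≡⟨ *-identityˡ 1ℚ ⟩
        1ℚ                                        ∎)
      Tser-coefficient k@(suc k′) = begin
        Tser n e k
          ≡⟨ cong₂ _*_ outer (sumL-applyUpTo (innerTerm k) k′ suc) ⟩
        ((M + - K) * invFact k) * sumTo k′ (λ i → innerTerm k (suc i))
          ≡⟨ cong (((M + - K) * invFact k) *_) (innerSum≡ k′) ⟩
        ((M + - K) * invFact k) * ((fact k * 1/M) * Σ)
          ≡⟨ solve 5 (λ A I F 1/M Σ → (A :* I) :* ((F :* 1/M) :* Σ) := (I :* F) :* ((A :* 1/M) :* Σ))
               refl (M + - K) (invFact k) (fact k) 1/M Σ ⟩
        (invFact k * fact k) * (((M + - K) * 1/M) * Σ)
          ≡⟨ trans (cong (_* (((M + - K) * 1/M) * Σ)) (invFact-inverseˡ k)) (*-identityˡ _) ⟩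
        ((M + - K) * 1/M) * Σ ∎
        where
        open +-*-Solver
        K = ℕ→ℚ k
        Σ = sumTo k (λ j → negBinomial n j * (U ^S j) k)
        outer : ((ℤ.+ (n ℕ.+ 1) ℤ.- ℤ.+ k) / (k !)) {{ℕ._!≢0 k}} ≡ (M + - K) * invFact k
        outer = trans (/-as-* (ℤ.+ (n ℕ.+ 1) ℤ.- ℤ.+ k) (k !) {{ℕ._!≢0 k}})
          (cong (_* invFact k) (trans (ℤ→ℚ-homo-+ (ℤ.+ (n ℕ.+ 1)) (ℤ.- ℤ.+ k))
            (cong₂ _+_ (cong ℕ→ℚ (ℕ.+-comm n 1)) (ℤ→ℚ-homo‿- (ℤ.+ k)))))

open import Data.Nat using (ℕ; _≤_; _+_; suc)
open import Data.Integer using (ℤ)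
open import Data.Rational as ℚ using (_*_)
open import Relation.Binary.PropositionalEquality using (_≡_; refl; cong; sym; module ≡-Reasoning)
open RationalArithmetic using (1/ℕ)
open NegativeBinomialSeries using (negBinomial; module ExpansionOfInversePower)
open DerivativeOfInversePower using (invS-^S-*S-[E+W]-coefficient)
open CoefficientsOfTser using (U; Eser≈1+U; Tser-coefficient)

lemma4p5 : (e : ℕ → ℤ) (n : ℕ) → 1 ≤ n →
    ∀ k → Tser n e k ≡ ((invS (Eser e) ^S (n + 2)) *S (Eser e +S xDeriv (Eser e))) k
lemma4p5 e n _ k = begin
  Tser n e k
    ≡⟨ Tser-coefficient e n k ⟩
  c * sumTo k (λ j → negBinomial n j * (U e ^S j) k)
    ≡⟨ cong (c *_) (sym (ExpansionOfInversePower.invS-^S-coefficient (Eser e) (U e) (Eser≈1+U e) refl n k)) ⟩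
  c * (invS (Eser e) ^S suc n) k
    ≡⟨ sym (invS-^S-*S-[E+W]-coefficient (Eser e) refl n k) ⟩
  ((invS (Eser e) ^S (n + 2)) *S (Eser e +S xDeriv (Eser e))) k ∎
  where
  open ≡-Reasoning
  c = (ℕ→ℚ (suc n) ℚ.+ ℚ.- ℕ→ℚ k) * 1/ℕ (suc n)
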